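{- Let $p$ be a prime, $q=p^{r}$ ($r\in\mathbb{N}$), $k\geq 3$ an integer with $k\mid(q-1)$, $m=(q-1)/k$, $F=\mathrm{GF}(q)$, and let $\Phi$ be the unique multiplicative subgroup of order $k$ of $F^{*}$. Assume that $(q,k)$ is circular. Let $N$ be the number of solutions $(x,y,z)\in F^{3}$ of $x^{m}+y^{m}-z^{m}=1$, and $N'$ the number of those solutions with $xyz\neq 0$. (1) If $k$ is even, then \[ N=\begin{cases}3(k-1)m^{3}+6m^{2}+3m, & \text{if } 6\mid k;\\ 3(k-1)m^{3}+3m^{2}+3m, & \text{if } p=3;\\ 3(k-1)m^{3}+3m, & \text{otherwise},\end{cases} \] and $N'=3(k-1)m^{3}$. (2) If $k$ is odd, then \[ N=\begin{cases}(3k-2)m^{3}+6m^{2}+3m, & \text{if } p=2 \text{ and } 3\mid k;\\ (3k-2)m^{3}+3m, & \text{if } p=2 \text{ and } 3\nmid k;\\ (2k-1)m^{3}+3m^{2}+2m, & \text{if } 2\in\Phi;\\ (2k-1)m^{3}+2m, & \text{otherwise},\end{cases} \] and $N'=(3k-2)m^{3}$ if $p=2$, $N'=(2k-1)m^{3}$ otherwise.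
   Context: The pair $(q,k)$ (equivalently $(F,\Phi)$) is called circular if $|\Phi a\cap(\Phi b+c)|\leq 2$ for all $a,b,c\in F^{*}=F\setminus\{0\}$. -}

module Defs where

open import Level using (0ℓ)
open import Data.Nat using (ℕ; zero; suc)
open import Data.Fin using (Fin)
open import Data.List using (List; length; filter; allFin; map)
open import Data.Nat.ListAction using (sum)
open import Relation.Nullary.Decidable using (_×-dec_; ¬?)
open import Data.Product using (Σ; _×_; ∃)
open import Data.Sum using (_⊎_)
open import Relation.Nullary using (¬_; Dec)
open import Relation.Unary using (Decidable)
open import Relation.Binary.PropositionalEquality using (_≡_; _≢_)
open import Relation.Binary.Definitions using (DecidableEquality)
open import Function.Bundles using (_↔_; Inverse)
import Algebra.Structures as AS

record FiniteField : Set₁ where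
  field
    Carrier : Set
    _+_ _*_ : Carrier → Carrier → Carrier
    -_      : Carrier → Carrier
    0# 1#   : Carrier
    isCommutativeRing : AS.IsCommutativeRing {A = Carrier} _≡_ _+_ _*_ -_ 0# 1#
    0≢1     : 0# ≢ 1#
    inv     : (x : Carrier) → x ≢ 0# → Σ Carrier (λ y → x * y ≡ 1#)
    size    : ℕ
    enum    : Fin size ↔ Carrier
  infixl 6 _+_
  infixl 7 _*_

module _ (F : FiniteField) where
  open FiniteField F

  pow : Carrier → ℕ → Carrier
  pow x zero = 1#
  pow x (suc n) = x * pow x n

  two : Carrier
  two = 1# + 1#

  _≟F_ : DecidableEquality Carrier
  x ≟F y with Data.Fin._≟_ (Inverse.from enum x) (Inverse.from enum y)
  ... | Relation.Nullary.yes e = Relation.Nullary.yes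
          (Relation.Binary.PropositionalEquality.trans
            (Relation.Binary.PropositionalEquality.sym (Inverse.inverseˡ enum {x} Relation.Binary.PropositionalEquality.refl))
            (Relation.Binary.PropositionalEquality.trans
              (Relation.Binary.PropositionalEquality.cong (Inverse.to enum) e)
              (Inverse.inverseˡ enum {y} Relation.Binary.PropositionalEquality.refl)))
  ... | Relation.Nullary.no ne = Relation.Nullary.no
          (λ e → ne (Relation.Binary.PropositionalEquality.cong (Inverse.from enum) e))

  countF : {P : Carrier → Set} → Decidable P → ℕ
  countF P? = length (filter (λ i → P? (Inverse.to enum i)) (allFin size))

  record IsSubgroupOfOrder (Φ : Carrier → Set) (k : ℕ) : Set where
    field
      dec      : Decidable Φ
      nonzero  : ∀ {x} → Φ x → x ≢ 0#
      one      : Φ 1#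
      mulClosed : ∀ {x y} → Φ x → Φ y → Φ (x * y)
      invClosed : ∀ {x y} → Φ x → x * y ≡ 1# → Φ y
      order    : countF dec ≡ k

  InCoset : (Carrier → Set) → Carrier → Carrier → Set
  InCoset Φ a x = ∃ λ φ → Φ φ × x ≡ φ * a

  InShift : (Carrier → Set) → Carrier → Carrier → Carrier → Set
  InShift Φ b c x = ∃ λ φ → Φ φ × x ≡ φ * b + c

  AtMostTwo : (Carrier → Set) → Set
  AtMostTwo S = ∀ x y z → S x → S y → S z → (x ≡ y) ⊎ (x ≡ z) ⊎ (y ≡ z)

  Circular : (Carrier → Set) → Set
  Circular Φ = ∀ a b c → a ≢ 0# → b ≢ 0# → c ≢ 0# →
    AtMostTwo (λ x → InCoset Φ a x × InShift Φ b c x)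

  Eqn : ℕ → Carrier → Carrier → Carrier → Set
  Eqn m x y z = pow x m + pow y m + - pow z m ≡ 1#

  count3 : (P : Carrier → Carrier → Carrier → Set) →
           (∀ x y z → Dec (P x y z)) → ℕ
  count3 P P? = countTriple
    where
      countTriple : ℕ
      countTriple = sum (map (λ i → sum (map (λ j →
        countF (λ z → P? (Inverse.to enum i) (Inverse.to enum j) z)) (allFin size))) (allFin size))

  N : ℕ → ℕ
  N m = count3 (Eqn m) (λ x y z → (pow x m + pow y m + - pow z m) ≟F 1#)

  N' : ℕ → ℕ
  N' m = count3 (λ x y z → Eqn m x y z × (x * y * z) ≢ 0#)
    (λ x y z → ((pow x m + pow y m + - pow z m) ≟F 1#)
                 ×-dec ¬? ((x * y * z) ≟F 0#))

module Submission where

-- The map x ↦ x^m sends F* onto Φ with fibres of size m and fixes 0, so N counts the solutions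
-- (u, v, w) of u + v - w = 1 with coordinates in {0} ∪ Φ, each weighted by m to the number of
-- nonzero coordinates:
--   N = m [-1 ∈ Φ] + 2m + 2m² #{u ∈ Φ : u - 1 ∈ Φ} + m² #{u ∈ Φ : 1 - u ∈ Φ} + m³ T,   N' = m³ T,
-- where T counts the solutions in Φ³. For fixed w ∈ Φ the admissible u form Φ ∩ (1 + w - Φ), which
-- contains 1 and w and by circularity nothing else, unless w = 1 (one element if the characteristic
-- is not 2) or w = -1 (all of Φ); summing over w gives T. Circularity with c = 1 pins down the two
-- small counts in terms of whether 2 ∈ Φ and whether x² - x + 1 has a root in Φ, and root counting
-- in Φ shows that such a root exists exactly when 6 ∣ k (3 ∣ k in characteristic 2).

open import Defs
open import Data.Nat as ℕ using (ℕ; zero; suc; _≤_; _<_; _∸_; _%_; _/_; z≤n; s≤s)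
import Data.Nat.Properties as ℕP
open import Data.Nat.Tactic.RingSolver using (solve-∀)
open import Data.Nat.ListAction using (sum)
open import Data.Nat.DivMod using (m≡m%n+[m/n]*n; m%n<n)
open import Data.Nat.Divisibility using (_∣_; divides; m%n≡0⇒n∣m; ∣-trans; ∣n⇒∣m*n)
open import Data.Nat.GCD using (gcd; gcd-GCD; gcd[m,n]∣m; gcd[m,n]∣n; module Bézout)
open import Data.Nat.Primality using (Prime; prime?; prime[2]; prime⇒irreducible; ¬prime[1])
open import Data.Integer as ℤ using (ℤ; sign; ∣_∣; _◃_; _⊖_)
import Data.Integer.Properties as ℤP
open import Data.Sign as Sign using (Sign)
open import Data.Maybe using (Maybe; just; nothing)
open import Data.Product using (Σ; _,_; proj₁; proj₂; _×_)
open import Data.Sum as Sum using (_⊎_; inj₁; inj₂)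
open import Data.Empty using (⊥; ⊥-elim)
open import Data.List using (List; []; _∷_; length; filter; map; allFin; foldr)
open import Data.List.Properties using (length-map; length-tabulate)
open import Data.List.Membership.Propositional using (_∈_; _∉_; find; lose)
open import Data.List.Membership.Propositional.Properties using (∈-map⁺; ∈-map⁻; ∈-allFin; ∈-filter⁺; ∈-filter⁻)
open import Data.List.Membership.Propositional.Properties.WithK using (unique∧set⇒bag)
open import Data.List.Relation.Unary.Any using (here; there; any?)
open import Data.List.Relation.Unary.All as All using (All; _∷_)
open import Data.List.Relation.Unary.AllPairs using (_∷_)
open import Data.List.Relation.Unary.Unique.Propositional using (Unique)
open import Data.List.Relation.Unary.Unique.Propositional.Properties using (map⁺; allFin⁺; filter⁺)
open import Data.List.Relation.Binary.BagAndSetEquality using (∼bag⇒↭)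
open import Data.List.Relation.Binary.Permutation.Propositional using (_↭_; ↭⇒↭ₛ)
import Data.List.Relation.Binary.Permutation.Setoid.Properties as Permutationₛ
open import Function.Base using (_∘_)
open import Function.Bundles using (Inverse; mk⇔)
open import Relation.Nullary using (¬_; Dec; yes; no)
open import Relation.Nullary.Decidable using (_×-dec_; ¬?; from-yes)
open import Relation.Unary using (Decidable)
open import Relation.Binary.Definitions using (DecidableEquality)
open import Relation.Binary.PropositionalEquality
open import Algebra.Bundles using (CommutativeRing; RawRing)
open import Algebra.Solver.Ring.AlmostCommutativeRing
  using (AlmostCommutativeRing; fromCommutativeRing; _-Raw-AlmostCommutative⟶_)

module Counting where

  open import Data.Nat using (_+_; _*_)

  𝟙 : ∀ {P : Set} → Dec P → ℕ
  𝟙 (yes _) = 1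
  𝟙 (no _) = 0

  𝟙-yes : ∀ {P : Set} (d : Dec P) → P → 𝟙 d ≡ 1
  𝟙-yes (yes _) _ = refl
  𝟙-yes (no ¬p) p = ⊥-elim (¬p p)

  𝟙-no : ∀ {P : Set} (d : Dec P) → ¬ P → 𝟙 d ≡ 0
  𝟙-no (yes p) ¬p = ⊥-elim (¬p p)
  𝟙-no (no _) _ = refl

  𝟙-cong : ∀ {P Q : Set} (d : Dec P) (e : Dec Q) → (P → Q) → (Q → P) → 𝟙 d ≡ 𝟙 e
  𝟙-cong (yes _) (yes _) _ _ = refl
  𝟙-cong (yes p) (no ¬q) f _ = ⊥-elim (¬q (f p))
  𝟙-cong (no ¬p) (yes q) _ g = ⊥-elim (¬p (g q))
  𝟙-cong (no _) (no _) _ _ = refl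

  𝟙≤1 : ∀ {P : Set} (d : Dec P) → 𝟙 d ≤ 1
  𝟙≤1 (yes _) = s≤s z≤n
  𝟙≤1 (no _) = z≤n

  module _ {A : Set} where

    ∑ : List A → (A → ℕ) → ℕ
    ∑ [] f = 0
    ∑ (x ∷ xs) f = f x + ∑ xs f

    syntax ∑ xs (λ x → e) = ∑[ x ∈ xs ] e

    sum-map : ∀ xs (f : A → ℕ) → sum (map f xs) ≡ ∑ xs f
    sum-map [] f = refl
    sum-map (x ∷ xs) f = cong (f x +_) (sum-map xs f)

    ∑-cong-∈ : ∀ xs {f g : A → ℕ} → (∀ x → x ∈ xs → f x ≡ g x) → ∑ xs f ≡ ∑ xs g
    ∑-cong-∈ [] _ = refl
    ∑-cong-∈ (x ∷ xs) f≗g = cong₂ _+_ (f≗g x (here refl)) (∑-cong-∈ xs (λ y y∈ → f≗g y (there y∈)))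

    ∑-cong : ∀ xs {f g : A → ℕ} → (∀ x → f x ≡ g x) → ∑ xs f ≡ ∑ xs g
    ∑-cong xs f≗g = ∑-cong-∈ xs (λ x _ → f≗g x)

    ∑-+ : ∀ xs (f g : A → ℕ) → ∑[ x ∈ xs ] (f x + g x) ≡ ∑ xs f + ∑ xs g
    ∑-+ [] _ _ = refl
    ∑-+ (x ∷ xs) f g = trans (cong (f x + g x +_) (∑-+ xs f g)) (interchange (f x) (g x) _ _)
      where
      interchange : ∀ a b c d → a + b + (c + d) ≡ a + c + (b + d)
      interchange = solve-∀

    ∑-*ˡ : ∀ xs c (f : A → ℕ) → ∑[ x ∈ xs ] (c * f x) ≡ c * ∑ xs f
    ∑-*ˡ [] c _ = sym (ℕP.*-zeroʳ c)
    ∑-*ˡ (x ∷ xs) c f = trans (cong (c * f x +_) (∑-*ˡ xs c f)) (sym (ℕP.*-distribˡ-+ c (f x) _))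

    ∑-*ʳ : ∀ xs (f : A → ℕ) c → ∑[ x ∈ xs ] (f x * c) ≡ ∑ xs f * c
    ∑-*ʳ xs f c = trans (∑-cong xs (λ x → ℕP.*-comm (f x) c)) (trans (∑-*ˡ xs c f) (ℕP.*-comm c _))

    ∑-linear : ∀ xs (f g : A → ℕ) c → ∑[ x ∈ xs ] (f x + c * g x) ≡ ∑ xs f + c * ∑ xs g
    ∑-linear xs f g c = trans (∑-+ xs f _) (cong (∑ xs f +_) (∑-*ˡ xs c g))

    ∑-const : ∀ xs c → ∑[ _ ∈ xs ] c ≡ length xs * c
    ∑-const [] _ = refl
    ∑-const (_ ∷ xs) c = cong (c +_) (∑-const xs c)

    ∑-zero : ∀ xs {f : A → ℕ} → (∀ x → x ∈ xs → f x ≡ 0) → ∑ xs f ≡ 0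
    ∑-zero xs f≡0 = trans (∑-cong-∈ xs f≡0) (trans (∑-const xs 0) (ℕP.*-zeroʳ (length xs)))

    ∑-mono-≤ : ∀ xs {f g : A → ℕ} → (∀ x → x ∈ xs → f x ≤ g x) → ∑ xs f ≤ ∑ xs g
    ∑-mono-≤ [] _ = z≤n
    ∑-mono-≤ (x ∷ xs) f≤g = ℕP.+-mono-≤ (f≤g x (here refl)) (∑-mono-≤ xs (λ y y∈ → f≤g y (there y∈)))

    length-filter : ∀ {P : A → Set} (P? : Decidable P) xs → length (filter P? xs) ≡ ∑[ x ∈ xs ] 𝟙 (P? x)
    length-filter P? [] = refl
    length-filter P? (x ∷ xs) with P? x
    ... | yes _ = cong suc (length-filter P? xs)
    ... | no _ = length-filter P? xs

    ∑-filter : ∀ {P : A → Set} (P? : Decidable P) xs (f : A → ℕ) →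
      ∑ (filter P? xs) f ≡ ∑[ x ∈ xs ] (𝟙 (P? x) * f x)
    ∑-filter P? [] f = refl
    ∑-filter P? (x ∷ xs) f with P? x
    ... | yes _ = cong₂ _+_ (sym (ℕP.+-identityʳ (f x))) (∑-filter P? xs f)
    ... | no _ = ∑-filter P? xs f

    ∑-tight : ∀ xs (f : A → ℕ) m → (∀ x → x ∈ xs → f x ≤ m) → ∑ xs f ≡ length xs * m →
      ∀ x → x ∈ xs → f x ≡ m
    ∑-tight (y ∷ xs) f m f≤m total x x∈ = helper x∈
      where
      rest≤ : ∑ xs f ≤ length xs * m
      rest≤ = ℕP.≤-trans (∑-mono-≤ xs (λ z z∈ → f≤m z (there z∈))) (ℕP.≤-reflexive (∑-const xs m))
      fy≡m : f y ≡ m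
      fy≡m = ℕP.≤-antisym (f≤m y (here refl))
        (ℕP.+-cancelʳ-≤ (∑ xs f) m (f y) (ℕP.≤-trans (ℕP.+-monoʳ-≤ m rest≤) (ℕP.≤-reflexive (sym total))))
      helper : x ∈ y ∷ xs → f x ≡ m
      helper (here refl) = fy≡m
      helper (there x∈xs) = ∑-tight xs f m (λ z z∈ → f≤m z (there z∈))
        (ℕP.+-cancelˡ-≡ m _ _ (trans (cong (_+ ∑ xs f) (sym fy≡m)) total)) x x∈xs

  module _ {A B : Set} where

    ∑-map : ∀ xs (g : A → B) (f : B → ℕ) → ∑ (map g xs) f ≡ ∑[ x ∈ xs ] f (g x)
    ∑-map [] g f = refl
    ∑-map (x ∷ xs) g f = cong (f (g x) +_) (∑-map xs g f)

    ∑-swap : ∀ xs ys (f : A → B → ℕ) → ∑[ x ∈ xs ] ∑[ y ∈ ys ] f x y ≡ ∑[ y ∈ ys ] ∑[ x ∈ xs ] f x y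
    ∑-swap [] ys f = sym (∑-zero ys (λ _ _ → refl))
    ∑-swap (x ∷ xs) ys f = trans (cong (∑ ys (f x) +_) (∑-swap xs ys f)) (sym (∑-+ ys (f x) _))

  module WithDecidableEquality {A : Set} (_≟_ : DecidableEquality A) where

    count-absent : ∀ xs a → a ∉ xs → ∑[ x ∈ xs ] 𝟙 (x ≟ a) ≡ 0
    count-absent xs a a∉ = ∑-zero xs (λ x x∈ → 𝟙-no (x ≟ a) (λ { refl → a∉ x∈ }))

    count-point : ∀ xs → Unique xs → ∀ a → a ∈ xs → ∑[ x ∈ xs ] 𝟙 (x ≟ a) ≡ 1
    count-point (y ∷ xs) (y∉ ∷ _) a (here refl) =
      cong₂ _+_ (𝟙-yes (y ≟ y) refl) (count-absent xs y (λ y∈ → All.lookup y∉ y∈ refl))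
    count-point (y ∷ xs) (y∉ ∷ u) a (there a∈) =
      cong₂ _+_ (𝟙-no (y ≟ a) (All.lookup y∉ a∈)) (count-point xs u a a∈)

    ∑-pick : ∀ xs → Unique xs → ∀ a → a ∈ xs → (f : A → ℕ) → ∑[ x ∈ xs ] (𝟙 (x ≟ a) * f x) ≡ f a
    ∑-pick (y ∷ xs) (y∉ ∷ _) a (here refl) f =
      trans (cong₂ _+_ (cong (_* f y) (𝟙-yes (y ≟ y) refl)) rest) (trans (ℕP.+-identityʳ _) (ℕP.+-identityʳ _))
      where
      rest : ∑[ x ∈ xs ] (𝟙 (x ≟ y) * f x) ≡ 0
      rest = ∑-zero xs (λ x x∈ → cong (_* f x) (𝟙-no (x ≟ y) (λ { refl → All.lookup y∉ x∈ refl })))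
    ∑-pick (y ∷ xs) (y∉ ∷ u) a (there a∈) f =
      cong₂ _+_ (cong (_* f y) (𝟙-no (y ≟ a) (All.lookup y∉ a∈))) (∑-pick xs u a a∈ f)

    count≡0 : ∀ xs {P : A → Set} (P? : Decidable P) → (∀ x → x ∈ xs → ¬ P x) → ∑[ x ∈ xs ] 𝟙 (P? x) ≡ 0
    count≡0 xs P? none = ∑-zero xs (λ x x∈ → 𝟙-no (P? x) (none x x∈))

    count≡1 : ∀ xs → Unique xs → ∀ {P : A → Set} (P? : Decidable P) a → a ∈ xs →
      (∀ x → x ∈ xs → P x → x ≡ a) → P a → ∑[ x ∈ xs ] 𝟙 (P? x) ≡ 1
    count≡1 xs u P? a a∈ only Pa =
      trans (∑-cong-∈ xs (λ x x∈ → 𝟙-cong (P? x) (x ≟ a) (only x x∈) (λ { refl → Pa }))) (count-point xs u a a∈)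

    count≡2 : ∀ xs → Unique xs → ∀ {P : A → Set} (P? : Decidable P) a b → a ∈ xs → b ∈ xs → a ≢ b →
      (∀ x → x ∈ xs → P x → x ≡ a ⊎ x ≡ b) → P a → P b → ∑[ x ∈ xs ] 𝟙 (P? x) ≡ 2
    count≡2 xs u P? a b a∈ b∈ a≢b only Pa Pb =
      trans (∑-cong-∈ xs split) (trans (∑-+ xs _ _) (cong₂ _+_ (count-point xs u a a∈) (count-point xs u b b∈)))
      where
      split : ∀ x → x ∈ xs → 𝟙 (P? x) ≡ 𝟙 (x ≟ a) + 𝟙 (x ≟ b)
      split x x∈ with P? x | x ≟ a | x ≟ b
      ... | _ | yes refl | yes refl = ⊥-elim (a≢b refl)
      ... | yes _ | yes _ | no _ = refl
      ... | yes _ | no _ | yes _ = refl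
      ... | yes Px | no x≢a | no x≢b = ⊥-elim (Sum.[ x≢a , x≢b ] (only x x∈ Px))
      ... | no ¬Px | yes refl | _ = ⊥-elim (¬Px Pa)
      ... | no ¬Px | no _ | yes refl = ⊥-elim (¬Px Pb)
      ... | no _ | no _ | no _ = refl

    1≤count : ∀ xs → Unique xs → ∀ {P : A → Set} (P? : Decidable P) a → a ∈ xs → P a →
      1 ≤ ∑[ x ∈ xs ] 𝟙 (P? x)
    1≤count xs u P? a a∈ Pa = ℕP.≤-trans (ℕP.≤-reflexive (sym (count-point xs u a a∈))) (∑-mono-≤ xs pointwise)
      where
      pointwise : ∀ x → x ∈ xs → 𝟙 (x ≟ a) ≤ 𝟙 (P? x)
      pointwise x _ with P? x | x ≟ a
      ... | yes _ | d = 𝟙≤1 d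
      ... | no ¬Px | yes refl = ⊥-elim (¬Px Pa)
      ... | no _ | no _ = z≤n

    2≤count : ∀ xs → Unique xs → ∀ {P : A → Set} (P? : Decidable P) a b → a ∈ xs → b ∈ xs → a ≢ b →
      P a → P b → 2 ≤ ∑[ x ∈ xs ] 𝟙 (P? x)
    2≤count xs u P? a b a∈ b∈ a≢b Pa Pb =
      ℕP.≤-trans (ℕP.≤-reflexive (sym (trans (∑-+ xs _ _) (cong₂ _+_ (count-point xs u a a∈) (count-point xs u b b∈)))))
        (∑-mono-≤ xs pointwise)
      where
      pointwise : ∀ x → x ∈ xs → 𝟙 (x ≟ a) + 𝟙 (x ≟ b) ≤ 𝟙 (P? x)
      pointwise x _ with P? x | x ≟ a | x ≟ b
      ... | _ | yes refl | yes refl = ⊥-elim (a≢b refl)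
      ... | yes _ | yes _ | no _ = ℕP.≤-refl
      ... | yes _ | no _ | yes _ = ℕP.≤-refl
      ... | yes _ | no _ | no _ = z≤n
      ... | no ¬Px | yes refl | _ = ⊥-elim (¬Px Pa)
      ... | no ¬Px | no _ | yes refl = ⊥-elim (¬Px Pb)
      ... | no _ | no _ | no _ = z≤n

module FieldArithmetic (F : FiniteField) where

  open FiniteField F public
  open ≡-Reasoning

  commutativeRing : CommutativeRing _ _
  commutativeRing = record { isCommutativeRing = isCommutativeRing }

  open CommutativeRing commutativeRing public
    using (+-assoc; +-comm; *-assoc; *-comm; +-identityˡ; +-identityʳ; *-identityˡ; *-identityʳ;
           -‿inverseʳ; zeroˡ; zeroʳ; ring; semiring; +-abelianGroup; +-isCommutativeMonoid; *-isCommutativeMonoid)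
  open import Algebra.Properties.Ring ring public using (-‿distribʳ-*; -1*x≈-x)
  open import Algebra.Properties.AbelianGroup +-abelianGroup public using (⁻¹-involutive; ⁻¹-∙-comm; ε⁻¹≈ε)
  open import Algebra.Properties.Semiring.Mult.TCOptimised semiring using (×-homo-+; ×1-homo-*) renaming (_×_ to _times_)

  infix 4 _≟_
  _≟_ : (x y : Carrier) → Dec (x ≡ y)
  _≟_ = _≟F_ F

  infixl 6 _-_
  _-_ : Carrier → Carrier → Carrier
  x - y = x + - y

  infixr 8 _^_
  _^_ : Carrier → ℕ → Carrier
  _^_ = pow F

  -- ι 2 unfolds to 1# + 1#, which is how Defs writes the element two.
  ι : ℕ → Carrier
  ι n = n times 1#

  ι-+ : ∀ m n → ι (m ℕ.+ n) ≡ ι m + ι n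
  ι-+ = ×-homo-+ 1#

  ι-* : ∀ m n → ι (m ℕ.* n) ≡ ι m * ι n
  ι-* = ×1-homo-*

  ιℤ : ℤ → Carrier
  ιℤ (ℤ.+ n) = ι n
  ιℤ ℤ.-[1+ n ] = - ι (suc n)

  private
    ι-suc : ∀ n → ι (suc n) ≡ 1# + ι n
    ι-suc n = ι-+ 1 n

    1+x-[1+y]≡x-y : ∀ x y → (1# + x) - (1# + y) ≡ x - y
    1+x-[1+y]≡x-y x y = begin
      (1# + x) + - (1# + y)   ≡⟨ cong ((1# + x) +_) (sym (⁻¹-∙-comm 1# y)) ⟩
      (1# + x) + (- 1# + - y) ≡⟨ +-assoc 1# x _ ⟩
      1# + (x + (- 1# + - y)) ≡⟨ cong (1# +_) (trans (sym (+-assoc x _ _)) (cong (_+ - y) (+-comm x (- 1#)))) ⟩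
      1# + ((- 1# + x) + - y) ≡⟨ cong (1# +_) (+-assoc (- 1#) x _) ⟩
      1# + (- 1# + (x - y))   ≡⟨ sym (+-assoc 1# (- 1#) _) ⟩
      (1# - 1#) + (x - y)     ≡⟨ cong (_+ (x - y)) (-‿inverseʳ 1#) ⟩
      0# + (x - y)            ≡⟨ +-identityˡ _ ⟩
      x - y                   ∎

    ιℤ-⊖ : ∀ m n → ιℤ (m ⊖ n) ≡ ι m - ι n
    ιℤ-⊖ m zero = begin
      ιℤ (m ⊖ 0)   ≡⟨ cong ιℤ (ℤP.⊖-≥ {m} {0} ℕ.z≤n) ⟩
      ι m          ≡⟨ sym (+-identityʳ _) ⟩
      ι m + 0#     ≡⟨ cong (ι m +_) (sym ε⁻¹≈ε) ⟩
      ι m - 0#     ∎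
    ιℤ-⊖ zero (suc n) = sym (+-identityˡ _)
    ιℤ-⊖ (suc m) (suc n) = begin
      ιℤ (suc m ⊖ suc n)            ≡⟨ cong ιℤ (ℤP.[1+m]⊖[1+n]≡m⊖n m n) ⟩
      ιℤ (m ⊖ n)                    ≡⟨ ιℤ-⊖ m n ⟩
      ι m - ι n                     ≡⟨ sym (1+x-[1+y]≡x-y _ _) ⟩
      (1# + ι m) - (1# + ι n)       ≡⟨ sym (cong₂ _-_ (ι-suc m) (ι-suc n)) ⟩
      ι (suc m) - ι (suc n)         ∎

    ιℤ-+ : ∀ i j → ιℤ (i ℤ.+ j) ≡ ιℤ i + ιℤ j
    ιℤ-+ (ℤ.+ m) (ℤ.+ n) = ι-+ m n
    ιℤ-+ (ℤ.+ m) ℤ.-[1+ n ] = ιℤ-⊖ m (suc n)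
    ιℤ-+ ℤ.-[1+ m ] (ℤ.+ n) = trans (ιℤ-⊖ n (suc m)) (+-comm _ _)
    ιℤ-+ ℤ.-[1+ m ] ℤ.-[1+ n ] = begin
      - ι (suc (suc (m ℕ.+ n)))     ≡⟨ cong -_ (ι-suc (suc (m ℕ.+ n))) ⟩
      - (1# + ι (suc m ℕ.+ n))      ≡⟨ cong (λ t → - (1# + t)) (ι-+ (suc m) n) ⟩
      - (1# + (ι (suc m) + ι n))    ≡⟨ cong -_ (trans (sym (+-assoc _ _ _)) (cong (_+ ι n) (+-comm 1# _))) ⟩
      - ((ι (suc m) + 1#) + ι n)    ≡⟨ cong -_ (trans (+-assoc _ _ _) (cong (ι (suc m) +_) (sym (ι-suc n)))) ⟩
      - (ι (suc m) + ι (suc n))     ≡⟨ sym (⁻¹-∙-comm _ _) ⟩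
      - ι (suc m) + - ι (suc n)     ∎

    signF : Sign → Carrier
    signF Sign.+ = 1#
    signF Sign.- = - 1#

    ιℤ-◃ : ∀ s n → ιℤ (s ◃ n) ≡ signF s * ι n
    ιℤ-◃ s zero = sym (zeroʳ _)
    ιℤ-◃ Sign.+ (suc n) = sym (*-identityˡ _)
    ιℤ-◃ Sign.- (suc n) = sym (-1*x≈-x _)

    signF-* : ∀ s t → signF (s Sign.* t) ≡ signF s * signF t
    signF-* Sign.+ t = sym (*-identityˡ _)
    signF-* Sign.- Sign.+ = sym (*-identityʳ _)
    signF-* Sign.- Sign.- = begin
      1#             ≡⟨ sym (⁻¹-involutive 1#) ⟩
      - - 1#         ≡⟨ cong -_ (sym (-1*x≈-x 1#)) ⟩
      - (- 1# * 1#)  ≡⟨ -‿distribʳ-* _ _ ⟩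
      - 1# * - 1#    ∎

    ιℤ-signF : ∀ i → ιℤ i ≡ signF (sign i) * ι ∣ i ∣
    ιℤ-signF i = trans (cong ιℤ (sym (ℤP.◃-inverse i))) (ιℤ-◃ (sign i) ∣ i ∣)

    interchange : ∀ a b c d → (a * b) * (c * d) ≡ (a * c) * (b * d)
    interchange a b c d = begin
      (a * b) * (c * d)  ≡⟨ *-assoc a b _ ⟩
      a * (b * (c * d))  ≡⟨ cong (a *_) (trans (sym (*-assoc b c d)) (cong (_* d) (*-comm b c))) ⟩
      a * ((c * b) * d)  ≡⟨ cong (a *_) (*-assoc c b d) ⟩
      a * (c * (b * d))  ≡⟨ sym (*-assoc a c _) ⟩
      (a * c) * (b * d)  ∎

    ιℤ-* : ∀ i j → ιℤ (i ℤ.* j) ≡ ιℤ i * ιℤ j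
    ιℤ-* i j = begin
      ιℤ (i ℤ.* j)                                             ≡⟨ ιℤ-◃ (sign i Sign.* sign j) (∣ i ∣ ℕ.* ∣ j ∣) ⟩
      signF (sign i Sign.* sign j) * ι (∣ i ∣ ℕ.* ∣ j ∣)       ≡⟨ cong₂ _*_ (signF-* (sign i) (sign j)) (ι-* ∣ i ∣ ∣ j ∣) ⟩
      (signF (sign i) * signF (sign j)) * (ι ∣ i ∣ * ι ∣ j ∣)  ≡⟨ interchange _ _ _ _ ⟩
      (signF (sign i) * ι ∣ i ∣) * (signF (sign j) * ι ∣ j ∣)  ≡⟨ sym (cong₂ _*_ (ιℤ-signF i) (ιℤ-signF j)) ⟩
      ιℤ i * ιℤ j                                              ∎

    ιℤ-neg : ∀ i → ιℤ (ℤ.- i) ≡ - ιℤ i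
    ιℤ-neg (ℤ.+ zero) = sym ε⁻¹≈ε
    ιℤ-neg (ℤ.+ suc n) = refl
    ιℤ-neg ℤ.-[1+ n ] = sym (⁻¹-involutive _)

    ℤ-rawRing : RawRing _ _
    ℤ-rawRing = record
      { Carrier = ℤ ; _≈_ = _≡_ ; _+_ = ℤ._+_ ; _*_ = ℤ._*_ ; -_ = ℤ.-_ ; 0# = ℤ.+ 0 ; 1# = ℤ.+ 1 }

    almostCommutativeRing : AlmostCommutativeRing _ _
    almostCommutativeRing = fromCommutativeRing commutativeRing

    ιℤ-homomorphism : ℤ-rawRing -Raw-AlmostCommutative⟶ almostCommutativeRing
    ιℤ-homomorphism = record
      { ⟦_⟧ = ιℤ ; +-homo = ιℤ-+ ; *-homo = ιℤ-* ; -‿homo = ιℤ-neg ; 0-homo = refl ; 1-homo = refl }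

    ιℤ-≟ : ∀ i j → Maybe (ιℤ i ≡ ιℤ j)
    ιℤ-≟ i j with i ℤ.≟ j
    ... | yes i≡j = just (cong ιℤ i≡j)
    ... | no _ = nothing

  -- With integer coefficients the normal forms compute, so solve n (λ … → lhs := rhs) refl proves
  -- any commutative-ring identity in F.
  open import Algebra.Solver.Ring ℤ-rawRing almostCommutativeRing ιℤ-homomorphism ιℤ-≟ public
    using (solve; _:=_; _:+_; _:*_; _:-_; :-_; con; Polynomial)

  c0 c1 c2 c3 : ∀ {n} → Polynomial n
  c0 = con (ℤ.+ 0)
  c1 = con (ℤ.+ 1)
  c2 = con (ℤ.+ 2)
  c3 = con (ℤ.+ 3)

  1≢0 : 1# ≢ 0#
  1≢0 1≡0 = 0≢1 (sym 1≡0)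

  -1≢0 : - 1# ≢ 0#
  -1≢0 -1≡0 = 1≢0 (trans (sym (⁻¹-involutive 1#)) (trans (cong -_ -1≡0) ε⁻¹≈ε))

  x-y≡0⇒x≡y : ∀ {x y} → x - y ≡ 0# → x ≡ y
  x-y≡0⇒x≡y {x} {y} x-y≡0 = begin
    x            ≡⟨ solve 2 (λ x y → x := (x :- y) :+ y) refl x y ⟩
    (x - y) + y  ≡⟨ cong (_+ y) x-y≡0 ⟩
    0# + y       ≡⟨ +-identityˡ y ⟩
    y            ∎

  x≡y⇒x-y≡0 : ∀ {x y} → x ≡ y → x - y ≡ 0#
  x≡y⇒x-y≡0 {x} refl = -‿inverseʳ x

  _⁻¹⟨_⟩ : (x : Carrier) → x ≢ 0# → Carrier
  x ⁻¹⟨ x≢0 ⟩ = proj₁ (inv x x≢0)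

  *-inverseʳ : ∀ x (x≢0 : x ≢ 0#) → x * x ⁻¹⟨ x≢0 ⟩ ≡ 1#
  *-inverseʳ x x≢0 = proj₂ (inv x x≢0)

  *-inverseˡ : ∀ x (x≢0 : x ≢ 0#) → x ⁻¹⟨ x≢0 ⟩ * x ≡ 1#
  *-inverseˡ x x≢0 = trans (*-comm _ x) (*-inverseʳ x x≢0)

  *-cancelˡ : ∀ {a x y} → a ≢ 0# → a * x ≡ a * y → x ≡ y
  *-cancelˡ {a} {x} {y} a≢0 ax≡ay = begin
    x              ≡⟨ sym (*-identityˡ x) ⟩
    1# * x         ≡⟨ cong (_* x) (sym (*-inverseˡ a a≢0)) ⟩
    (a⁻¹ * a) * x  ≡⟨ *-assoc a⁻¹ a x ⟩
    a⁻¹ * (a * x)  ≡⟨ cong (a⁻¹ *_) ax≡ay ⟩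
    a⁻¹ * (a * y)  ≡⟨ sym (*-assoc a⁻¹ a y) ⟩
    (a⁻¹ * a) * y  ≡⟨ cong (_* y) (*-inverseˡ a a≢0) ⟩
    1# * y         ≡⟨ *-identityˡ y ⟩
    y              ∎
    where a⁻¹ = a ⁻¹⟨ a≢0 ⟩

  x*y≡0⇒x≡0∨y≡0 : ∀ {x y} → x * y ≡ 0# → x ≡ 0# ⊎ y ≡ 0#
  x*y≡0⇒x≡0∨y≡0 {x} {y} xy≡0 with x ≟ 0#
  ... | yes x≡0 = inj₁ x≡0
  ... | no x≢0 = inj₂ (*-cancelˡ x≢0 (trans xy≡0 (sym (zeroʳ x))))

  *-nonzero : ∀ {x y} → x ≢ 0# → y ≢ 0# → x * y ≢ 0#
  *-nonzero x≢0 y≢0 xy≡0 with x*y≡0⇒x≡0∨y≡0 xy≡0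
  ... | inj₁ x≡0 = x≢0 x≡0
  ... | inj₂ y≡0 = y≢0 y≡0

  x*x≡1⇒x≡±1 : ∀ x → x * x ≡ 1# → x ≡ 1# ⊎ x ≡ - 1#
  x*x≡1⇒x≡±1 x x²≡1 with x*y≡0⇒x≡0∨y≡0 {x - 1#} {x + 1#} factored
    where
    factored : (x - 1#) * (x + 1#) ≡ 0#
    factored = trans (solve 1 (λ x → (x :- c1) :* (x :+ c1) := x :* x :- c1) refl x) (x≡y⇒x-y≡0 x²≡1)
  ... | inj₁ x-1≡0 = inj₁ (x-y≡0⇒x≡y x-1≡0)
  ... | inj₂ x+1≡0 = inj₂ (x-y≡0⇒x≡y (trans (solve 1 (λ x → x :- :- c1 := x :+ c1) refl x) x+1≡0))

  ^-distribˡ-+-* : ∀ x a b → x ^ (a ℕ.+ b) ≡ x ^ a * x ^ b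
  ^-distribˡ-+-* x zero b = sym (*-identityˡ _)
  ^-distribˡ-+-* x (suc a) b = trans (cong (x *_) (^-distribˡ-+-* x a b)) (sym (*-assoc _ _ _))

  ^-distribʳ-* : ∀ x y n → (x * y) ^ n ≡ x ^ n * y ^ n
  ^-distribʳ-* x y zero = sym (*-identityˡ _)
  ^-distribʳ-* x y (suc n) = trans (cong ((x * y) *_) (^-distribʳ-* x y n)) (interchange x y (x ^ n) (y ^ n))

  1^n≡1 : ∀ n → 1# ^ n ≡ 1#
  1^n≡1 zero = refl
  1^n≡1 (suc n) = trans (*-identityˡ _) (1^n≡1 n)

  ^-*-assoc : ∀ x a b → (x ^ a) ^ b ≡ x ^ (a ℕ.* b)
  ^-*-assoc x zero b = 1^n≡1 b
  ^-*-assoc x (suc a) b = begin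
    (x * x ^ a) ^ b          ≡⟨ ^-distribʳ-* x (x ^ a) b ⟩
    x ^ b * (x ^ a) ^ b      ≡⟨ cong (x ^ b *_) (^-*-assoc x a b) ⟩
    x ^ b * x ^ (a ℕ.* b)    ≡⟨ sym (^-distribˡ-+-* x b (a ℕ.* b)) ⟩
    x ^ (b ℕ.+ a ℕ.* b)      ∎

  x≢0⇒x^n≢0 : ∀ {x} n → x ≢ 0# → x ^ n ≢ 0#
  x≢0⇒x^n≢0 zero _ = 1≢0
  x≢0⇒x^n≢0 (suc n) x≢0 = *-nonzero x≢0 (x≢0⇒x^n≢0 n x≢0)

  x^[1+n]≡0⇒x≡0 : ∀ {x} n → x ^ suc n ≡ 0# → x ≡ 0#
  x^[1+n]≡0⇒x≡0 {x} n x^n≡0 with x ≟ 0#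
  ... | yes x≡0 = x≡0
  ... | no x≢0 = ⊥-elim (x≢0⇒x^n≢0 (suc n) x≢0 x^n≡0)

  ι2≡0⇒-1≡1 : ι 2 ≡ 0# → - 1# ≡ 1#
  ι2≡0⇒-1≡1 ι2≡0 = begin
    - 1#           ≡⟨ solve 0 (:- c1 := c1 :- c2) refl ⟩
    1# - ι 2       ≡⟨ cong (λ t → 1# - t) ι2≡0 ⟩
    1# - 0#        ≡⟨ solve 0 (c1 :- c0 := c1) refl ⟩
    1#             ∎

  ι2≡0⇒ι3≡1 : ι 2 ≡ 0# → ι 3 ≡ 1#
  ι2≡0⇒ι3≡1 ι2≡0 = trans (solve 0 (c3 := c2 :+ c1) refl) (trans (cong (_+ 1#) ι2≡0) (+-identityˡ 1#))

module Polynomials (F : FiniteField) where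

  open FieldArithmetic F
  open ≡-Reasoning

  -- Polynomial functions in Horner form: Poly n f says that f has degree < n,
  -- Monic n f that f is monic of degree n.
  Poly : ℕ → (Carrier → Carrier) → Set
  Poly zero f = ∀ x → f x ≡ 0#
  Poly (suc n) f = Σ Carrier λ c → Σ (Carrier → Carrier) λ g → Poly n g × (∀ x → f x ≡ c + x * g x)

  Monic : ℕ → (Carrier → Carrier) → Set
  Monic zero f = ∀ x → f x ≡ 1#
  Monic (suc n) f = Σ Carrier λ c → Σ (Carrier → Carrier) λ g → Monic n g × (∀ x → f x ≡ c + x * g x)

  Poly-resp : ∀ n {f g} → (∀ x → f x ≡ g x) → Poly n f → Poly n g
  Poly-resp zero f≗g f≡0 x = trans (sym (f≗g x)) (f≡0 x)
  Poly-resp (suc n) f≗g (c , h , h-poly , f≡) = c , h , h-poly , (λ x → trans (sym (f≗g x)) (f≡ x))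

  Poly-zero : ∀ n → Poly n (λ _ → 0#)
  Poly-zero zero _ = refl
  Poly-zero (suc n) = 0# , (λ _ → 0#) , Poly-zero n , (λ x → solve 1 (λ x → c0 := c0 :+ x :* c0) refl x)

  Poly-const : ∀ n c → Poly (suc n) (λ _ → c)
  Poly-const n c = c , (λ _ → 0#) , Poly-zero n , (λ x → solve 2 (λ c x → c := c :+ x :* c0) refl c x)

  Poly-x* : ∀ n {f} → Poly n f → Poly (suc n) (λ x → x * f x)
  Poly-x* n f-poly = 0# , _ , f-poly , (λ x → sym (+-identityˡ _))

  Poly-pow : ∀ n b → b < n → Poly n (λ x → x ^ b)
  Poly-pow (suc n) zero _ = Poly-const n 1#
  Poly-pow (suc n) (suc b) (s≤s b<n) = Poly-x* n (Poly-pow n b b<n)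

  Poly-+ : ∀ n {f g} → Poly n f → Poly n g → Poly n (λ x → f x + g x)
  Poly-+ zero f≡0 g≡0 x = trans (cong₂ _+_ (f≡0 x) (g≡0 x)) (+-identityˡ 0#)
  Poly-+ (suc n) (c , f' , f'-poly , f≡) (d , g' , g'-poly , g≡) =
    c + d , _ , Poly-+ n f'-poly g'-poly ,
    (λ x → trans (cong₂ _+_ (f≡ x) (g≡ x))
      (solve 5 (λ c d x a b → (c :+ x :* a) :+ (d :+ x :* b) := (c :+ d) :+ x :* (a :+ b)) refl c d x (f' x) (g' x)))

  Poly-scale : ∀ n a {f} → Poly n f → Poly n (λ x → a * f x)
  Poly-scale zero a f≡0 x = trans (cong (a *_) (f≡0 x)) (zeroʳ a)
  Poly-scale (suc n) a (c , f' , f'-poly , f≡) =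
    a * c , _ , Poly-scale n a f'-poly ,
    (λ x → trans (cong (a *_) (f≡ x)) (solve 4 (λ a c x b → a :* (c :+ x :* b) := a :* c :+ x :* (a :* b)) refl a c x (f' x)))

  Monic-pow : ∀ n → Monic n (λ x → x ^ n)
  Monic-pow zero _ = refl
  Monic-pow (suc n) = 0# , _ , Monic-pow n , (λ x → sym (+-identityˡ _))

  Monic-+ : ∀ n {f g} → Monic n f → Poly n g → Monic n (λ x → f x + g x)
  Monic-+ zero f≡1 g≡0 x = trans (cong₂ _+_ (f≡1 x) (g≡0 x)) (+-identityʳ 1#)
  Monic-+ (suc n) (c , f' , f'-monic , f≡) (d , g' , g'-poly , g≡) =
    c + d , _ , Monic-+ n f'-monic g'-poly ,
    (λ x → trans (cong₂ _+_ (f≡ x) (g≡ x))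
      (solve 5 (λ c d x a b → (c :+ x :* a) :+ (d :+ x :* b) := (c :+ d) :+ x :* (a :+ b)) refl c d x (f' x) (g' x)))

  Monic-pow+const : ∀ n → 1 ≤ n → (c : Carrier) → Monic n (λ x → x ^ n + c)
  Monic-pow+const (suc n) _ c = Monic-+ (suc n) (Monic-pow (suc n)) (Poly-const n c)

  Monic⇒Poly : ∀ n {f} → Monic n f → Poly (suc n) f
  Monic⇒Poly zero f≡1 = 1# , (λ _ → 0#) , (λ _ → refl) , (λ x → trans (f≡1 x) (solve 1 (λ x → c1 := c1 :+ x :* c0) refl x))
  Monic⇒Poly (suc n) (c , g , g-monic , f≡) = c , g , Monic⇒Poly n g-monic , f≡

  Monic-factor : ∀ n {f} → Monic (suc n) f → (a : Carrier) →
    Σ (Carrier → Carrier) λ q → Monic n q × (∀ x → f x ≡ (x - a) * q x + f a)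
  Monic-factor zero {f} (c , g , g≡1 , f≡) a = (λ _ → 1#) , (λ _ → refl) , (λ x → begin
    f x                          ≡⟨ f≡ x ⟩
    c + x * g x                  ≡⟨ cong (λ t → c + x * t) (g≡1 x) ⟩
    c + x * 1#                   ≡⟨ solve 3 (λ c x a → c :+ x :* c1 := (x :- a) :* c1 :+ (c :+ a :* c1)) refl c x a ⟩
    (x - a) * 1# + (c + a * 1#)  ≡⟨ cong (λ t → (x - a) * 1# + (c + a * t)) (sym (g≡1 a)) ⟩
    (x - a) * 1# + (c + a * g a) ≡⟨ cong ((x - a) * 1# +_) (sym (f≡ a)) ⟩
    (x - a) * 1# + f a           ∎)
  Monic-factor (suc n) {f} (c , g , g-monic , f≡) a with Monic-factor n g-monic a
  ... | q , q-monic , g≡ = (λ x → g x + a * q x) , Monic-+ (suc n) g-monic (Poly-scale (suc n) a (Monic⇒Poly n q-monic)) ,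
    (λ x → begin
      f x                                           ≡⟨ f≡ x ⟩
      c + x * g x                                   ≡⟨ cong (λ t → c + x * t) (g≡ x) ⟩
      c + x * ((x - a) * q x + g a)                 ≡⟨ solve 5 (λ x a c q ga → c :+ x :* ((x :- a) :* q :+ ga)
                                                         := (x :- a) :* (((x :- a) :* q :+ ga) :+ a :* q) :+ (c :+ a :* ga)) refl x a c (q x) (g a) ⟩
      (x - a) * (((x - a) * q x + g a) + a * q x) + (c + a * g a)
                                                    ≡⟨ cong₂ (λ t u → (x - a) * (t + a * q x) + u) (sym (g≡ x)) (sym (f≡ a)) ⟩
      (x - a) * (g x + a * q x) + f a               ∎)

  Monic-roots : ∀ n {f} → Monic n f → (xs : List Carrier) → Unique xs → All (λ x → f x ≡ 0#) xs → length xs ≤ n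
  Monic-roots n f-monic [] _ _ = z≤n
  Monic-roots zero f≡1 (a ∷ _) _ (fa≡0 ∷ _) = ⊥-elim (1≢0 (trans (sym (f≡1 a)) fa≡0))
  Monic-roots (suc n) {f} f-monic (a ∷ xs) (a∉ ∷ unique) (fa≡0 ∷ roots) with Monic-factor n f-monic a
  ... | q , q-monic , f≡ = s≤s (Monic-roots n q-monic xs unique (All.zipWith root-of-q (a∉ , roots)))
    where
    root-of-q : ∀ {b} → (a ≢ b) × (f b ≡ 0#) → q b ≡ 0#
    root-of-q {b} (a≢b , fb≡0) with x*y≡0⇒x≡0∨y≡0 {b - a} {q b} (begin
        (b - a) * q b        ≡⟨ sym (+-identityʳ _) ⟩
        (b - a) * q b + 0#   ≡⟨ cong ((b - a) * q b +_) (sym fa≡0) ⟩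
        (b - a) * q b + f a  ≡⟨ sym (f≡ b) ⟩
        f b                  ≡⟨ fb≡0 ⟩
        0#                   ∎)
    ... | inj₁ b-a≡0 = ⊥-elim (a≢b (sym (x-y≡0⇒x≡y b-a≡0)))
    ... | inj₂ qb≡0 = qb≡0

module _ {A : Set} where

  ↭-from-members : ∀ {xs ys : List A} → Unique xs → Unique ys →
    (∀ {z} → z ∈ xs → z ∈ ys) → (∀ {z} → z ∈ ys → z ∈ xs) → xs ↭ ys
  ↭-from-members xs-unique ys-unique ⊆ ⊇ = ∼bag⇒↭ (unique∧set⇒bag xs-unique ys-unique (mk⇔ ⊆ ⊇))

module Enumeration (F : FiniteField) where

  open FieldArithmetic F
  open Counting
  open ≡-Reasoning

  elements : List Carrier
  elements = map (Inverse.to enum) (allFin size)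

  ∈-elements : ∀ x → x ∈ elements
  ∈-elements x = subst (_∈ elements) (Inverse.inverseˡ enum refl) (∈-map⁺ _ (∈-allFin (Inverse.from enum x)))

  elements-unique : Unique elements
  elements-unique = map⁺ to-injective (allFin⁺ size)
    where
    to-injective : ∀ {i j} → Inverse.to enum i ≡ Inverse.to enum j → i ≡ j
    to-injective {i} {j} eq =
      trans (sym (Inverse.inverseʳ enum refl)) (trans (cong (Inverse.from enum) eq) (Inverse.inverseʳ enum refl))

  length-elements : length elements ≡ size
  length-elements = trans (length-map _ (allFin size)) (length-tabulate (λ i → i))

  open WithDecidableEquality _≟_ public

  ∑-allFin : (f : Carrier → ℕ) → ∑[ i ∈ allFin size ] f (Inverse.to enum i) ≡ ∑ elements f
  ∑-allFin f = sym (∑-map (allFin size) (Inverse.to enum) f)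

  countF≡∑ : ∀ {P : Carrier → Set} (P? : Decidable P) → countF F P? ≡ ∑[ x ∈ elements ] 𝟙 (P? x)
  countF≡∑ P? = trans (length-filter _ (allFin size)) (∑-allFin (λ x → 𝟙 (P? x)))

  private
    ∏ ∑F : List Carrier → Carrier
    ∏ = foldr _*_ 1#
    ∑F = foldr _+_ 0#

    ∏-↭ : ∀ {xs ys} → xs ↭ ys → ∏ xs ≡ ∏ ys
    ∏-↭ p = Permutationₛ.foldr-commMonoid (setoid Carrier) *-isCommutativeMonoid (↭⇒↭ₛ p)

    ∑F-↭ : ∀ {xs ys} → xs ↭ ys → ∑F xs ≡ ∑F ys
    ∑F-↭ p = Permutationₛ.foldr-commMonoid (setoid Carrier) +-isCommutativeMonoid (↭⇒↭ₛ p)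

  -- Lagrange for a finite multiplicative group: multiplying by x permutes it,
  -- so comparing products gives x ^ |G| = 1.
  module SubgroupFermat {P : Carrier → Set} (P? : Decidable P)
    (*-closed : ∀ {x y} → P x → P y → P (x * y))
    (inverse-closed : ∀ {x y} → P x → x * y ≡ 1# → P y)
    (P⇒≢0 : ∀ {x} → P x → x ≢ 0#) where

    members : List Carrier
    members = filter P? elements

    members-unique : Unique members
    members-unique = filter⁺ P? elements-unique

    ∏-nonzero : ∀ xs → All P xs → ∏ xs ≢ 0#
    ∏-nonzero [] _ = 1≢0
    ∏-nonzero (x ∷ xs) (Px ∷ Pxs) = *-nonzero (P⇒≢0 Px) (∏-nonzero xs Pxs)

    ∏-map-* : ∀ x xs → ∏ (map (x *_) xs) ≡ x ^ length xs * ∏ xs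
    ∏-map-* x [] = sym (*-identityˡ 1#)
    ∏-map-* x (y ∷ xs) = trans (cong ((x * y) *_) (∏-map-* x xs))
      (solve 4 (λ x y a b → (x :* y) :* (a :* b) := (x :* a) :* (y :* b)) refl x y (x ^ length xs) (∏ xs))

    fermat : ∀ x → P x → x ^ length members ≡ 1#
    fermat x Px = *-cancelˡ (∏-nonzero members (All.tabulate (λ z∈ → proj₂ (∈-filter⁻ P? {xs = elements} z∈))))
      (begin
        ∏ members * x ^ length members  ≡⟨ *-comm _ _ ⟩
        x ^ length members * ∏ members  ≡⟨ sym (∏-map-* x members) ⟩
        ∏ (map (x *_) members)          ≡⟨ ∏-↭ permutes ⟩
        ∏ members                       ≡⟨ sym (*-identityʳ _) ⟩
        ∏ members * 1#                  ∎)
      where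
      x≢0 = P⇒≢0 Px
      x⁻¹ = x ⁻¹⟨ x≢0 ⟩
      permutes : map (x *_) members ↭ members
      permutes = ↭-from-members (map⁺ (*-cancelˡ x≢0) members-unique) members-unique ⊆ ⊇
        where
        ⊆ : ∀ {z} → z ∈ map (x *_) members → z ∈ members
        ⊆ z∈ with ∈-map⁻ (x *_) z∈
        ... | y , y∈ , refl = ∈-filter⁺ P? (∈-elements _) (*-closed Px (proj₂ (∈-filter⁻ P? {xs = elements} y∈)))
        ⊇ : ∀ {z} → z ∈ members → z ∈ map (x *_) members
        ⊇ {z} z∈ = subst (_∈ map (x *_) members) x[x⁻¹z]≡z
          (∈-map⁺ (x *_) (∈-filter⁺ P? (∈-elements _)
            (*-closed (inverse-closed Px (*-inverseʳ x x≢0)) (proj₂ (∈-filter⁻ P? {xs = elements} z∈)))))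
          where
          x[x⁻¹z]≡z : x * (x⁻¹ * z) ≡ z
          x[x⁻¹z]≡z = trans (sym (*-assoc _ _ _)) (trans (cong (_* z) (*-inverseʳ x x≢0)) (*-identityˡ z))

  -- Translation by 1 permutes F, so comparing sums gives |F| · 1 = 0.
  ι-size≡0 : ι size ≡ 0#
  ι-size≡0 = begin
    ι size                                         ≡⟨ cong ι (sym length-elements) ⟩
    ι (length elements)                            ≡⟨ solve 2 (λ a s → a := (a :+ s) :- s) refl (ι (length elements)) (∑F elements) ⟩
    (ι (length elements) + ∑F elements) - ∑F elements ≡⟨ cong (_- ∑F elements) (sym (∑F-map-1+ elements)) ⟩
    ∑F (map (1# +_) elements) - ∑F elements        ≡⟨ cong (_- ∑F elements) (∑F-↭ translate) ⟩
    ∑F elements - ∑F elements                      ≡⟨ -‿inverseʳ _ ⟩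
    0#                                             ∎
    where
    ∑F-map-1+ : ∀ xs → ∑F (map (1# +_) xs) ≡ ι (length xs) + ∑F xs
    ∑F-map-1+ [] = sym (+-identityˡ 0#)
    ∑F-map-1+ (y ∷ xs) = trans (cong ((1# + y) +_) (∑F-map-1+ xs))
      (trans (solve 4 (λ o y a b → (o :+ y) :+ (a :+ b) := (o :+ a) :+ (y :+ b)) refl 1# y (ι (length xs)) (∑F xs))
             (cong (_+ (y + ∑F xs)) (sym (ι-+ 1 (length xs)))))
    1+-injective : ∀ {a b} → 1# + a ≡ 1# + b → a ≡ b
    1+-injective {a} {b} eq = trans (solve 1 (λ a → a := (c1 :+ a) :- c1) refl a)
      (trans (cong (_- 1#) eq) (solve 1 (λ b → (c1 :+ b) :- c1 := b) refl b))
    translate : map (1# +_) elements ↭ elements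
    translate = ↭-from-members (map⁺ 1+-injective elements-unique) elements-unique (λ _ → ∈-elements _)
      (λ {z} _ → subst (_∈ map (1# +_) elements) (solve 1 (λ z → c1 :+ (z :- c1) := z) refl z)
        (∈-map⁺ (1# +_) (∈-elements (z - 1#))))

  ι[size∸1]≡-1 : ι (size ∸ 1) ≡ - 1#
  ι[size∸1]≡-1 = begin
    ι (size ∸ 1)                   ≡⟨ solve 1 (λ a → a := (c1 :+ a) :- c1) refl _ ⟩
    (1# + ι (size ∸ 1)) - 1#       ≡⟨ cong (_- 1#) (sym (ι-+ 1 (size ∸ 1))) ⟩
    ι (1 ℕ.+ (size ∸ 1)) - 1#      ≡⟨ cong (λ n → ι n - 1#) (ℕP.m+[n∸m]≡n 1≤size) ⟩
    ι size - 1#                    ≡⟨ cong (_- 1#) ι-size≡0 ⟩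
    0# - 1#                        ≡⟨ +-identityˡ _ ⟩
    - 1#                           ∎
    where
    1≤size : 1 ≤ size
    1≤size = subst (1 ≤_) length-elements (nonempty (∈-elements 0#))
      where
      nonempty : ∀ {xs : List Carrier} {x} → x ∈ xs → 1 ≤ length xs
      nonempty (here _) = s≤s z≤n
      nonempty (there _) = s≤s z≤n

*-monoʳ-<′ : ∀ j {a b} → 1 ≤ j → a < b → j ℕ.* a < j ℕ.* b
*-monoʳ-<′ (suc j) _ a<b = ℕP.*-monoʳ-< (suc j) a<b

module Subgroup (F : FiniteField) {Φ : FiniteField.Carrier F → Set} {k : ℕ} (isΦ : IsSubgroupOfOrder F Φ k) where

  open FieldArithmetic F
  open Counting
  open Polynomials F
  open Enumeration F
  open IsSubgroupOfOrder isΦ public using (order)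
    renaming (dec to Φ?; nonzero to Φ⇒≢0; one to Φ-one; mulClosed to Φ-*; invClosed to Φ-inverse)
  open ≡-Reasoning

  Φ-cong : ∀ {x y} → x ≡ y → Φ x → Φ y
  Φ-cong = subst Φ

  Φ-^ : ∀ {x} n → Φ x → Φ (x ^ n)
  Φ-^ zero _ = Φ-one
  Φ-^ (suc n) Φx = Φ-* Φx (Φ-^ n Φx)

  Φ-⁻¹ : ∀ {x} (Φx : Φ x) → Φ (x ⁻¹⟨ Φ⇒≢0 Φx ⟩)
  Φ-⁻¹ {x} Φx = Φ-inverse Φx (*-inverseʳ x (Φ⇒≢0 Φx))

  Φs : List Carrier
  Φs = filter Φ? elements

  Φs-unique : Unique Φs
  Φs-unique = filter⁺ Φ? elements-unique

  ∈Φs : ∀ {x} → Φ x → x ∈ Φs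
  ∈Φs Φx = ∈-filter⁺ Φ? (∈-elements _) Φx

  ∈Φs⇒Φ : ∀ {x} → x ∈ Φs → Φ x
  ∈Φs⇒Φ x∈ = proj₂ (∈-filter⁻ Φ? {xs = elements} x∈)

  length-Φs : length Φs ≡ k
  length-Φs = trans (length-filter Φ? elements) (trans (sym (countF≡∑ Φ?)) order)

  ∑Φ-const : ∀ c → ∑[ _ ∈ Φs ] c ≡ k ℕ.* c
  ∑Φ-const c = trans (∑-const Φs c) (cong (ℕ._* c) length-Φs)

  count-Φ-point : ∀ {a} → Φ a → ∑[ x ∈ Φs ] 𝟙 (x ≟ a) ≡ 1
  count-Φ-point Φa = count-point Φs Φs-unique _ (∈Φs Φa)

  1≤k : 1 ≤ k
  1≤k = subst (1 ≤_) (trans (sym (length-filter Φ? elements)) length-Φs)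
    (1≤count elements elements-unique Φ? 1# (∈-elements 1#) Φ-one)

  count-Φ-unique : ∀ {P : Carrier → Set} (P? : Decidable P) a → (∀ x → P x → x ≡ a) → P a →
    ∑[ x ∈ Φs ] 𝟙 (P? x) ≡ 𝟙 (Φ? a)
  count-Φ-unique P? a only Pa with Φ? a
  ... | yes Φa = count≡1 Φs Φs-unique P? a (∈Φs Φa) (λ x _ Px → only x Px) Pa
  ... | no ¬Φa = count≡0 Φs P? (λ x x∈ Px → ¬Φa (Φ-cong (only x Px) (∈Φs⇒Φ x∈)))

  Φ-fermat : ∀ {x} → Φ x → x ^ k ≡ 1#
  Φ-fermat {x} Φx = subst (λ n → x ^ n ≡ 1#) length-Φs (SubgroupFermat.fermat Φ? Φ-* Φ-inverse Φ⇒≢0 x Φx)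

  -- Φ already supplies k roots of x^k - 1, leaving no room for y outside Φ.
  x^k≡1⇒Φ : ∀ {y} → y ^ k ≡ 1# → Φ y
  x^k≡1⇒Φ {y} y^k≡1 with Φ? y
  ... | yes Φy = Φy
  ... | no ¬Φy = ⊥-elim (ℕP.<-irrefl refl (subst (λ n → suc n ≤ k) length-Φs
      (Monic-roots k (Monic-pow+const k 1≤k (- 1#)) (y ∷ Φs)
        (All.tabulate (λ z∈ y≡z → ¬Φy (Φ-cong (sym y≡z) (∈Φs⇒Φ z∈))) ∷ Φs-unique)
        (root y^k≡1 ∷ All.tabulate (λ z∈ → root (Φ-fermat (∈Φs⇒Φ z∈)))))))
    where
    root : ∀ {x} → x ^ k ≡ 1# → x ^ k - 1# ≡ 0#
    root = x≡y⇒x-y≡0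

  Φ-witness : ∀ {R : Carrier → Set} (R? : Decidable R) (f : Carrier → Carrier) n → Monic n f → n < k →
    (∀ φ → Φ φ → ¬ R φ → f φ ≡ 0#) → Σ Carrier λ φ → Φ φ × R φ
  Φ-witness R? f n f-monic n<k roots with any? R? Φs
  ... | yes some with find some
  ...   | φ , φ∈ , Rφ = φ , ∈Φs⇒Φ φ∈ , Rφ
  Φ-witness R? f n f-monic n<k roots | no none = ⊥-elim (ℕP.<⇒≱ n<k (subst (_≤ n) length-Φs
    (Monic-roots n f-monic Φs Φs-unique
      (All.tabulate (λ {φ} φ∈ → roots φ (∈Φs⇒Φ φ∈) (λ Rφ → none (lose φ∈ Rφ)))))))

  ∣k⇒1≤quotient : ∀ {d} j → k ≡ j ℕ.* d → 1 ≤ j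
  ∣k⇒1≤quotient zero k≡0 = ⊥-elim (ℕP.<⇒≱ 1≤k (ℕP.≤-reflexive k≡0))
  ∣k⇒1≤quotient (suc j) _ = s≤s z≤n

  -1∈Φ-if-even : 2 ∣ k → Φ (- 1#)
  -1∈Φ-if-even (divides j k≡j*2) with Φ-witness (λ φ → φ ^ j ≟ - 1#) (λ x → x ^ j - 1#) j
      (Monic-pow+const j 1≤j (- 1#)) j<k φ^j≡1
    where
    1≤j = ∣k⇒1≤quotient j k≡j*2
    j<k : j < k
    j<k = subst (j <_) (sym k≡j*2) (subst (_< j ℕ.* 2) (ℕP.*-identityʳ j) (*-monoʳ-<′ j 1≤j ℕP.≤-refl))
    φ^j≡1 : ∀ φ → Φ φ → ¬ φ ^ j ≡ - 1# → φ ^ j - 1# ≡ 0#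
    φ^j≡1 φ Φφ φ^j≢-1 with x*x≡1⇒x≡±1 (φ ^ j) (begin
        φ ^ j * φ ^ j        ≡⟨ cong (φ ^ j *_) (sym (*-identityʳ _)) ⟩
        (φ ^ j) ^ 2          ≡⟨ ^-*-assoc φ j 2 ⟩
        φ ^ (j ℕ.* 2)        ≡⟨ cong (φ ^_) (sym k≡j*2) ⟩
        φ ^ k                ≡⟨ Φ-fermat Φφ ⟩
        1#                   ∎)
    ... | inj₁ φ^j≡1 = x≡y⇒x-y≡0 φ^j≡1
    ... | inj₂ φ^j≡-1 = ⊥-elim (φ^j≢-1 φ^j≡-1)
  ... | φ , Φφ , φ^j≡-1 = Φ-cong φ^j≡-1 (Φ-^ j Φφ)

  Cyclo6 : Carrier → Set
  Cyclo6 ω = ω * ω - ω + 1# ≡ 0#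

  Cyclo6? : Decidable Cyclo6
  Cyclo6? ω = ω * ω - ω + 1# ≟ 0#

  Cyclo6⇒≢1 : ∀ {ω} → Cyclo6 ω → ω ≢ 1#
  Cyclo6⇒≢1 cyclo refl = 1≢0 (trans (solve 0 (c1 := c1 :* c1 :- c1 :+ c1) refl) cyclo)

  Cyclo6[-1]⇒ι3≡0 : Cyclo6 (- 1#) → ι 3 ≡ 0#
  Cyclo6[-1]⇒ι3≡0 cyclo = trans (solve 0 (c3 := :- c1 :* :- c1 :- :- c1 :+ c1) refl) cyclo

  Cyclo6⇒ω³≡-1 : ∀ {ω} → Cyclo6 ω → ω ^ 3 ≡ - 1#
  Cyclo6⇒ω³≡-1 {ω} cyclo = begin
    ω ^ 3                                 ≡⟨ solve 1 (λ w → w :* (w :* (w :* c1)) := :- c1 :+ (w :+ c1) :* (w :* w :- w :+ c1)) refl ω ⟩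
    - 1# + (ω + 1#) * (ω * ω - ω + 1#)     ≡⟨ cong (λ t → - 1# + (ω + 1#) * t) cyclo ⟩
    - 1# + (ω + 1#) * 0#                   ≡⟨ solve 1 (λ w → :- c1 :+ (w :+ c1) :* c0 := :- c1) refl ω ⟩
    - 1#                                  ∎

  ^[k%d]≡1 : ∀ {ω} d .{{_ : ℕ.NonZero d}} → Φ ω → ω ^ d ≡ 1# → ω ^ (k % d) ≡ 1#
  ^[k%d]≡1 {ω} d Φω ω^d≡1 = begin
    ω ^ (k % d)                        ≡⟨ sym (*-identityʳ _) ⟩
    ω ^ (k % d) * 1#                   ≡⟨ cong (ω ^ (k % d) *_) (sym ω^[d*q]≡1) ⟩
    ω ^ (k % d) * ω ^ (d ℕ.* (k / d))  ≡⟨ cong (λ t → ω ^ (k % d) * ω ^ t) (ℕP.*-comm d (k / d)) ⟩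
    ω ^ (k % d) * ω ^ ((k / d) ℕ.* d)  ≡⟨ sym (^-distribˡ-+-* ω (k % d) _) ⟩
    ω ^ (k % d ℕ.+ (k / d) ℕ.* d)      ≡⟨ cong (ω ^_) (sym (m≡m%n+[m/n]*n k d)) ⟩
    ω ^ k                              ≡⟨ Φ-fermat Φω ⟩
    1#                                 ∎
    where
    ω^[d*q]≡1 : ω ^ (d ℕ.* (k / d)) ≡ 1#
    ω^[d*q]≡1 = trans (sym (^-*-assoc ω d (k / d))) (trans (cong (_^ (k / d)) ω^d≡1) (1^n≡1 (k / d)))

  -1∈Φ⇒2∣k : ι 2 ≢ 0# → Φ (- 1#) → 2 ∣ k
  -1∈Φ⇒2∣k ι2≢0 Φ-1 = residue (k % 2) refl (m%n<n k 2)
    where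
    power : ∀ {t} → k % 2 ≡ t → (- 1#) ^ t ≡ 1#
    power refl = ^[k%d]≡1 2 Φ-1 (solve 0 (:- c1 :* (:- c1 :* c1) := c1) refl)
    residue : ∀ t → k % 2 ≡ t → t < 2 → 2 ∣ k
    residue 0 k%2≡0 _ = m%n≡0⇒n∣m k 2 k%2≡0
    residue 1 k%2≡1 _ = ⊥-elim (ι2≢0 (begin
      ι 2               ≡⟨ solve 0 (c2 := c1 :+ c1) refl ⟩
      1# + 1#           ≡⟨ cong (1# +_) (sym (trans (sym (*-identityʳ _)) (power k%2≡1))) ⟩
      1# + - 1#         ≡⟨ -‿inverseʳ 1# ⟩
      0#                ∎))
    residue (suc (suc _)) _ (s≤s (s≤s ()))

  -- In characteristic ≠ 2, 3 a root of ω² - ω + 1 in Φ has order 6, so 6 ∣ k.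
  Cyclo6⇒6∣k : ι 2 ≢ 0# → ι 3 ≢ 0# → ∀ {ω} → Φ ω → Cyclo6 ω → 6 ∣ k
  Cyclo6⇒6∣k ι2≢0 ι3≢0 {ω} Φω cyclo = residue (k % 6) refl (m%n<n k 6)
    where
    ω³≡-1 = Cyclo6⇒ω³≡-1 cyclo
    power : ∀ {t} → k % 6 ≡ t → ω ^ t ≡ 1#
    power refl = ^[k%d]≡1 6 Φω (trans (^-distribˡ-+-* ω 3 3) (trans (cong₂ _*_ ω³≡-1 ω³≡-1) (solve 0 (:- c1 :* :- c1 := c1) refl)))
    ω≢-1 : ω ≢ - 1#
    ω≢-1 refl = ι3≢0 (Cyclo6[-1]⇒ι3≡0 cyclo)
    residue : ∀ t → k % 6 ≡ t → t < 6 → 6 ∣ k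
    residue 0 k%6≡0 _ = m%n≡0⇒n∣m k 6 k%6≡0
    residue 1 k%6≡1 _ = ⊥-elim (Cyclo6⇒≢1 cyclo (trans (sym (*-identityʳ ω)) (power k%6≡1)))
    residue 2 k%6≡2 _ with x*x≡1⇒x≡±1 ω (trans (cong (ω *_) (sym (*-identityʳ ω))) (power k%6≡2))
    ... | inj₁ ω≡1 = ⊥-elim (Cyclo6⇒≢1 cyclo ω≡1)
    ... | inj₂ ω≡-1 = ⊥-elim (ω≢-1 ω≡-1)
    residue 3 k%6≡3 _ = ⊥-elim (ι2≢0 (begin
      ι 2           ≡⟨ solve 0 (c2 := c1 :+ c1) refl ⟩
      1# + 1#       ≡⟨ cong (1# +_) (sym (power k%6≡3)) ⟩
      1# + ω ^ 3    ≡⟨ cong (1# +_) ω³≡-1 ⟩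
      1# + - 1#     ≡⟨ -‿inverseʳ 1# ⟩
      0#            ∎))
    residue 4 k%6≡4 _ = ⊥-elim (ω≢-1 (begin
      ω             ≡⟨ solve 1 (λ w → w := :- (w :* :- c1)) refl ω ⟩
      - (ω * - 1#)  ≡⟨ cong (λ t → - (ω * t)) (sym ω³≡-1) ⟩
      - (ω ^ 4)     ≡⟨ cong -_ (power k%6≡4) ⟩
      - 1#          ∎))
    residue 5 k%6≡5 _ = ⊥-elim (Φ⇒≢0 Φω (begin
      ω                                   ≡⟨ solve 1 (λ w → w := :- (w :* w :- w :+ c1) :+ (w :* w :+ c1)) refl ω ⟩
      - (ω * ω - ω + 1#) + (ω * ω + 1#)   ≡⟨ cong₂ (λ a b → - a + b) cyclo ω²+1≡0 ⟩
      - 0# + 0#                           ≡⟨ solve 0 (:- c0 :+ c0 := c0) refl ⟩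
      0#                                  ∎))
      where
      ω²+1≡0 : ω * ω + 1# ≡ 0#
      ω²+1≡0 = begin
        ω * ω + 1#               ≡⟨ solve 1 (λ w → w :* w :+ c1 := c1 :- w :* (w :* :- c1)) refl ω ⟩
        1# - ω * (ω * - 1#)      ≡⟨ cong (λ t → 1# - ω * (ω * t)) (sym ω³≡-1) ⟩
        1# - ω ^ 5               ≡⟨ cong (λ t → 1# - t) (power k%6≡5) ⟩
        1# - 1#                  ≡⟨ -‿inverseʳ 1# ⟩
        0#                       ∎
    residue (suc (suc (suc (suc (suc (suc _)))))) _ (s≤s (s≤s (s≤s (s≤s (s≤s (s≤s ()))))))

  -- In characteristic 2 the same root has order 3.
  Cyclo6⇒3∣k : ι 2 ≡ 0# → ∀ {ω} → Φ ω → Cyclo6 ω → 3 ∣ k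
  Cyclo6⇒3∣k ι2≡0 {ω} Φω cyclo = residue (k % 3) refl (m%n<n k 3)
    where
    -1≡1 = ι2≡0⇒-1≡1 ι2≡0
    power : ∀ {t} → k % 3 ≡ t → ω ^ t ≡ 1#
    power refl = ^[k%d]≡1 3 Φω (trans (Cyclo6⇒ω³≡-1 cyclo) -1≡1)
    residue : ∀ t → k % 3 ≡ t → t < 3 → 3 ∣ k
    residue 0 k%3≡0 _ = m%n≡0⇒n∣m k 3 k%3≡0
    residue 1 k%3≡1 _ = ⊥-elim (Cyclo6⇒≢1 cyclo (trans (sym (*-identityʳ ω)) (power k%3≡1)))
    residue 2 k%3≡2 _ with x*x≡1⇒x≡±1 ω (trans (cong (ω *_) (sym (*-identityʳ ω))) (power k%3≡2))
    ... | inj₁ ω≡1 = ⊥-elim (Cyclo6⇒≢1 cyclo ω≡1)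
    ... | inj₂ ω≡-1 = ⊥-elim (Cyclo6⇒≢1 cyclo (trans ω≡-1 -1≡1))
    residue (suc (suc (suc _))) _ (s≤s (s≤s (s≤s ())))

  -- With k = 6j the elements φ^j are roots of x⁶ - 1 = (x² - x + 1)(x⁴ + x³ - x - 1).
  Cyclo6-witness-6∣k : 6 ∣ k → Σ Carrier λ ω → Φ ω × Cyclo6 ω
  Cyclo6-witness-6∣k (divides j k≡j*6) with Φ-witness (λ φ → Cyclo6? (φ ^ j)) f (j ℕ.* 4) f-monic 4j<k roots
    where
    1≤j = ∣k⇒1≤quotient j k≡j*6
    f : Carrier → Carrier
    f x = x ^ (j ℕ.* 4) + ((x ^ (j ℕ.* 3) - x ^ j) - 1#)
    f-monic : Monic (j ℕ.* 4) f
    f-monic = Monic-+ (j ℕ.* 4) (Monic-pow (j ℕ.* 4))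
      (Poly-resp (j ℕ.* 4) (λ x → cong (λ t → (x ^ (j ℕ.* 3) + t) + - 1#) (-1*x≈-x _))
        (Poly-+ (j ℕ.* 4)
          (Poly-+ (j ℕ.* 4) (Poly-pow (j ℕ.* 4) (j ℕ.* 3) (*-monoʳ-<′ j 1≤j (s≤s ℕP.≤-refl)))
                            (Poly-scale (j ℕ.* 4) (- 1#) (Poly-pow (j ℕ.* 4) j
                              (subst (_< j ℕ.* 4) (ℕP.*-identityʳ j) (*-monoʳ-<′ j 1≤j (s≤s (s≤s z≤n)))))))
          (subst (λ n → Poly n (λ _ → - 1#)) (ℕP.m+[n∸m]≡n 1≤4j) (Poly-const (j ℕ.* 4 ∸ 1) (- 1#)))))
      where
      1≤4j : 1 ≤ j ℕ.* 4
      1≤4j = ℕP.≤-trans 1≤j (ℕP.m≤m*n j 4)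
    4j<k : j ℕ.* 4 < k
    4j<k = subst (j ℕ.* 4 <_) (sym k≡j*6) (*-monoʳ-<′ j 1≤j (s≤s (s≤s (s≤s (s≤s (s≤s z≤n))))))
    roots : ∀ φ → Φ φ → ¬ Cyclo6 (φ ^ j) → f φ ≡ 0#
    roots φ Φφ ¬cyclo with x*y≡0⇒x≡0∨y≡0 {y * y - y + 1#} {y ^ 4 + ((y ^ 3 - y) - 1#)} factored
      where
      y = φ ^ j
      factored : (y * y - y + 1#) * (y ^ 4 + ((y ^ 3 - y) - 1#)) ≡ 0#
      factored = begin
        (y * y - y + 1#) * (y ^ 4 + ((y ^ 3 - y) - 1#))
          ≡⟨ solve 1 (λ y → (y :* y :- y :+ c1) :* (y :* (y :* (y :* (y :* c1))) :+ ((y :* (y :* (y :* c1)) :- y) :- c1))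
                            := y :* (y :* (y :* (y :* (y :* (y :* c1))))) :- c1) refl y ⟩
        y ^ 6 - 1#
          ≡⟨ cong (_- 1#) (trans (^-*-assoc φ j 6) (trans (cong (φ ^_) (sym k≡j*6)) (Φ-fermat Φφ))) ⟩
        1# - 1#
          ≡⟨ -‿inverseʳ 1# ⟩
        0# ∎
    ... | inj₁ cyclo = ⊥-elim (¬cyclo cyclo)
    ... | inj₂ rest≡0 = trans (cong₂ (λ a b → a + ((b - φ ^ j) - 1#)) (sym (^-*-assoc φ j 4)) (sym (^-*-assoc φ j 3))) rest≡0
  ... | φ , Φφ , cyclo = φ ^ j , Φ-^ j Φφ , cyclo

  -- In characteristic 2 and k = 3j: x³ - 1 = (x - 1)(x² - x + 1).
  Cyclo6-witness-char2 : ι 2 ≡ 0# → 3 ∣ k → Σ Carrier λ ω → Φ ω × Cyclo6 ω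
  Cyclo6-witness-char2 ι2≡0 (divides j k≡j*3) with Φ-witness (λ φ → Cyclo6? (φ ^ j)) (λ x → x ^ j - 1#) j
      (Monic-pow+const j 1≤j (- 1#)) j<k roots
    where
    1≤j = ∣k⇒1≤quotient j k≡j*3
    j<k : j < k
    j<k = subst (j <_) (sym k≡j*3) (subst (_< j ℕ.* 3) (ℕP.*-identityʳ j) (*-monoʳ-<′ j 1≤j (s≤s (s≤s z≤n))))
    roots : ∀ φ → Φ φ → ¬ Cyclo6 (φ ^ j) → φ ^ j - 1# ≡ 0#
    roots φ Φφ ¬cyclo with x*y≡0⇒x≡0∨y≡0 {y - 1#} {y * y - y + 1#} factored
      where
      y = φ ^ j
      factored : (y - 1#) * (y * y - y + 1#) ≡ 0#
      factored = begin
        (y - 1#) * (y * y - y + 1#)            ≡⟨ solve 1 (λ y → (y :- c1) :* (y :* y :- y :+ c1) := (y :* (y :* (y :* c1)) :- c1) :- c2 :* (y :* y :- y)) refl y ⟩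
        (y ^ 3 - 1#) - ι 2 * (y * y - y)       ≡⟨ cong₂ (λ a b → (a - 1#) - b * (y * y - y))
                                                  (trans (^-*-assoc φ j 3) (trans (cong (φ ^_) (sym k≡j*3)) (Φ-fermat Φφ))) ι2≡0 ⟩
        (1# - 1#) - 0# * (y * y - y)           ≡⟨ solve 1 (λ y → (c1 :- c1) :- c0 :* (y :* y :- y) := c0) refl y ⟩
        0#                                     ∎
    ... | inj₁ y-1≡0 = y-1≡0
    ... | inj₂ cyclo = ⊥-elim (¬cyclo cyclo)
  ... | φ , Φφ , cyclo = φ ^ j , Φ-^ j Φφ , cyclo

-- x ↦ x^m maps F* onto Φ with every fibre of size m (here |F*| = m k).
module PowerMap (F : FiniteField) {Φ : FiniteField.Carrier F → Set} {k : ℕ} (isΦ : IsSubgroupOfOrder F Φ k)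
  (m : ℕ) (size∸1≡m*k : FiniteField.size F ∸ 1 ≡ m ℕ.* k) where

  open FieldArithmetic F
  open Counting
  open Polynomials F
  open Enumeration F
  open Subgroup F isΦ
  open ≡-Reasoning

  private
    NonZero? : Decidable (λ x → x ≢ 0#)
    NonZero? x = ¬? (x ≟ 0#)

    open SubgroupFermat NonZero? *-nonzero
      (λ {x} x≢0 xy≡1 y≡0 → 1≢0 (trans (sym xy≡1) (trans (cong (x *_) y≡0) (zeroʳ x)))) (λ x≢0 → x≢0)
      renaming (members to nonzeros; fermat to nonzero-fermat)

    count-nonzero+1 : ∀ x → 𝟙 (NonZero? x) ℕ.+ 𝟙 (x ≟ 0#) ≡ 1
    count-nonzero+1 x with x ≟ 0#
    ... | yes _ = refl
    ... | no _ = refl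

  length-nonzeros : length nonzeros ≡ m ℕ.* k
  length-nonzeros = begin
    length nonzeros                     ≡⟨ sym (ℕP.m+n∸n≡m _ 1) ⟩
    length nonzeros ℕ.+ 1 ∸ 1           ≡⟨ cong (_∸ 1) (begin
      length nonzeros ℕ.+ 1                                            ≡⟨ cong₂ ℕ._+_ (length-filter NonZero? elements)
                                                                            (sym (count-point elements elements-unique 0# (∈-elements 0#))) ⟩
      ∑[ x ∈ elements ] 𝟙 (NonZero? x) ℕ.+ ∑[ x ∈ elements ] 𝟙 (x ≟ 0#) ≡⟨ sym (∑-+ elements _ _) ⟩
      ∑[ x ∈ elements ] (𝟙 (NonZero? x) ℕ.+ 𝟙 (x ≟ 0#))                ≡⟨ ∑-cong elements count-nonzero+1 ⟩
      ∑[ _ ∈ elements ] 1                                              ≡⟨ trans (∑-const elements 1) (ℕP.*-identityʳ _) ⟩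
      length elements                                                  ≡⟨ length-elements ⟩
      size                                                             ∎) ⟩
    size ∸ 1                            ≡⟨ size∸1≡m*k ⟩
    m ℕ.* k                             ∎

  1≤m : 1 ≤ m
  1≤m = 1≤a*b⇒1≤a m k (subst (1 ≤_) length-nonzeros 1≤∣F*∣)
    where
    1≤a*b⇒1≤a : ∀ a b → 1 ≤ a ℕ.* b → 1 ≤ a
    1≤a*b⇒1≤a (suc _) _ _ = s≤s z≤n
    1≤∣F*∣ : 1 ≤ length nonzeros
    1≤∣F*∣ = subst (1 ≤_) (sym (length-filter NonZero? elements))
      (1≤count elements elements-unique NonZero? 1# (∈-elements 1#) 1≢0)

  m≡1+[m∸1] : m ≡ suc (m ∸ 1)
  m≡1+[m∸1] = trans (sym (ℕP.m∸n+n≡m 1≤m)) (ℕP.+-comm (m ∸ 1) 1)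

  0^m≡0 : 0# ^ m ≡ 0#
  0^m≡0 = subst (λ n → 0# ^ n ≡ 0#) (sym m≡1+[m∸1]) (zeroˡ _)

  x^m≡0⇒x≡0 : ∀ {x} → x ^ m ≡ 0# → x ≡ 0#
  x^m≡0⇒x≡0 {x} x^m≡0 = x^[1+n]≡0⇒x≡0 (m ∸ 1) (subst (λ n → x ^ n ≡ 0#) m≡1+[m∸1] x^m≡0)

  Φ-x^m : ∀ {x} → x ≢ 0# → Φ (x ^ m)
  Φ-x^m {x} x≢0 = x^k≡1⇒Φ (trans (^-*-assoc x m k)
    (subst (λ n → x ^ n ≡ 1#) length-nonzeros (nonzero-fermat x x≢0)))

  fibre : Carrier → ℕ
  fibre y = ∑[ x ∈ elements ] 𝟙 (y ≟ x ^ m)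

  private
    fibre-0 : fibre 0# ≡ 1
    fibre-0 = count≡1 elements elements-unique (λ x → 0# ≟ x ^ m) 0# (∈-elements 0#)
      (λ x _ 0≡x^m → x^m≡0⇒x≡0 (sym 0≡x^m)) (sym 0^m≡0)

    fibre≤m : ∀ y → fibre y ≤ m
    fibre≤m y = subst (_≤ m) (length-filter (λ x → y ≟ x ^ m) elements)
      (Monic-roots m (Monic-pow+const m 1≤m (- y)) (filter (λ x → y ≟ x ^ m) elements)
        (filter⁺ _ elements-unique)
        (All.tabulate (λ x∈ → x≡y⇒x-y≡0 (sym (proj₂ (∈-filter⁻ (λ x → y ≟ x ^ m) {xs = elements} x∈))))))

    ∑Φ-fibre : ∑ Φs fibre ≡ length Φs ℕ.* m
    ∑Φ-fibre = begin
      ∑[ φ ∈ Φs ] ∑[ x ∈ elements ] 𝟙 (φ ≟ x ^ m)  ≡⟨ ∑-swap Φs elements _ ⟩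
      ∑[ x ∈ elements ] ∑[ φ ∈ Φs ] 𝟙 (φ ≟ x ^ m)  ≡⟨ ∑-cong elements hits ⟩
      ∑[ x ∈ elements ] 𝟙 (NonZero? x)            ≡⟨ sym (length-filter NonZero? elements) ⟩
      length nonzeros                             ≡⟨ length-nonzeros ⟩
      m ℕ.* k                                     ≡⟨ ℕP.*-comm m k ⟩
      k ℕ.* m                                     ≡⟨ cong (ℕ._* m) (sym length-Φs) ⟩
      length Φs ℕ.* m                             ∎
      where
      hits : ∀ x → ∑[ φ ∈ Φs ] 𝟙 (φ ≟ x ^ m) ≡ 𝟙 (NonZero? x)
      hits x with x ≟ 0#
      ... | yes refl = count-absent Φs (0# ^ m) (λ 0^m∈ → Φ⇒≢0 (∈Φs⇒Φ 0^m∈) 0^m≡0)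
      ... | no x≢0 = count-point Φs Φs-unique (x ^ m) (∈Φs (Φ-x^m x≢0))

    fibre-Φ : ∀ {φ} → Φ φ → fibre φ ≡ m
    fibre-Φ Φφ = ∑-tight Φs fibre m (λ y _ → fibre≤m y) ∑Φ-fibre _ (∈Φs Φφ)

    fibre-outside : ∀ {y} → y ≢ 0# → ¬ Φ y → fibre y ≡ 0
    fibre-outside {y} y≢0 ¬Φy = count≡0 elements (λ x → y ≟ x ^ m) (λ x _ y≡x^m → not-power x y≡x^m)
      where
      not-power : ∀ x → y ≡ x ^ m → ⊥
      not-power x y≡x^m with x ≟ 0#
      ... | yes refl = y≢0 (trans y≡x^m 0^m≡0)
      ... | no x≢0 = ¬Φy (Φ-cong (sym y≡x^m) (Φ-x^m x≢0))

    fibre-* : ∀ (h : Carrier → ℕ) y → fibre y ℕ.* h y ≡ 𝟙 (y ≟ 0#) ℕ.* h y ℕ.+ m ℕ.* (𝟙 (Φ? y) ℕ.* h y)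
    fibre-* h y with y ≟ 0# | Φ? y
    ... | yes refl | yes Φ0 = ⊥-elim (Φ⇒≢0 Φ0 refl)
    ... | yes refl | no _ = trans (cong (ℕ._* h 0#) fibre-0) (arith m (h 0#))
      where
      arith : ∀ m h → 1 ℕ.* h ≡ 1 ℕ.* h ℕ.+ m ℕ.* (0 ℕ.* h)
      arith = solve-∀
    ... | no _ | yes Φy = trans (cong (ℕ._* h y) (fibre-Φ Φy)) (arith m (h y))
      where
      arith : ∀ m h → m ℕ.* h ≡ 0 ℕ.* h ℕ.+ m ℕ.* (1 ℕ.* h)
      arith = solve-∀
    ... | no y≢0 | no ¬Φy = trans (cong (ℕ._* h y) (fibre-outside y≢0 ¬Φy)) (arith m (h y))
      where
      arith : ∀ m h → 0 ℕ.* h ≡ 0 ℕ.* h ℕ.+ m ℕ.* (0 ℕ.* h)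
      arith = solve-∀

  ∑-^m : ∀ (h : Carrier → ℕ) → ∑[ x ∈ elements ] h (x ^ m) ≡ h 0# ℕ.+ m ℕ.* ∑ Φs h
  ∑-^m h = begin
    ∑[ x ∈ elements ] h (x ^ m)
      ≡⟨ ∑-cong elements (λ x → sym (∑-pick elements elements-unique (x ^ m) (∈-elements _) h)) ⟩
    ∑[ x ∈ elements ] ∑[ y ∈ elements ] (𝟙 (y ≟ x ^ m) ℕ.* h y)
      ≡⟨ ∑-swap elements elements _ ⟩
    ∑[ y ∈ elements ] ∑[ x ∈ elements ] (𝟙 (y ≟ x ^ m) ℕ.* h y)
      ≡⟨ ∑-cong elements (λ y → ∑-*ʳ elements (λ x → 𝟙 (y ≟ x ^ m)) (h y)) ⟩
    ∑[ y ∈ elements ] (fibre y ℕ.* h y)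
      ≡⟨ ∑-cong elements (fibre-* h) ⟩
    ∑[ y ∈ elements ] (𝟙 (y ≟ 0#) ℕ.* h y ℕ.+ m ℕ.* (𝟙 (Φ? y) ℕ.* h y))
      ≡⟨ ∑-linear elements _ _ m ⟩
    ∑[ y ∈ elements ] (𝟙 (y ≟ 0#) ℕ.* h y) ℕ.+ m ℕ.* ∑[ y ∈ elements ] (𝟙 (Φ? y) ℕ.* h y)
      ≡⟨ cong₂ (λ a b → a ℕ.+ m ℕ.* b) (∑-pick elements elements-unique 0# (∈-elements 0#) h) (sym (∑-filter Φ? elements h)) ⟩
    h 0# ℕ.+ m ℕ.* ∑ Φs h
      ∎

  -- Expanding the three coordinates: each term is weighted by m to the number of nonzero coordinates.
  ∑³-^m : (g : Carrier → Carrier → Carrier → ℕ) →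
    ∑[ x ∈ elements ] ∑[ y ∈ elements ] ∑[ z ∈ elements ] g (x ^ m) (y ^ m) (z ^ m) ≡
    g 0# 0# 0#
    ℕ.+ m ℕ.* ∑[ w ∈ Φs ] g 0# 0# w
    ℕ.+ m ℕ.* ∑[ v ∈ Φs ] g 0# v 0#
    ℕ.+ m ℕ.* m ℕ.* ∑[ v ∈ Φs ] ∑[ w ∈ Φs ] g 0# v w
    ℕ.+ m ℕ.* ∑[ u ∈ Φs ] g u 0# 0#
    ℕ.+ m ℕ.* m ℕ.* ∑[ u ∈ Φs ] ∑[ w ∈ Φs ] g u 0# w
    ℕ.+ m ℕ.* m ℕ.* ∑[ u ∈ Φs ] ∑[ v ∈ Φs ] g u v 0#
    ℕ.+ m ℕ.* m ℕ.* m ℕ.* ∑[ u ∈ Φs ] ∑[ v ∈ Φs ] ∑[ w ∈ Φs ] g u v w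
  ∑³-^m g = begin
    ∑[ x ∈ elements ] ∑[ y ∈ elements ] ∑[ z ∈ elements ] g (x ^ m) (y ^ m) (z ^ m)
      ≡⟨ ∑-cong elements (λ x → ∑-cong elements (λ y → ∑-^m (g (x ^ m) (y ^ m)))) ⟩
    ∑[ x ∈ elements ] ∑[ y ∈ elements ] inner₂ (x ^ m) (y ^ m)
      ≡⟨ ∑-cong elements (λ x → ∑-^m (inner₂ (x ^ m))) ⟩
    ∑[ x ∈ elements ] inner₁ (x ^ m)
      ≡⟨ ∑-^m inner₁ ⟩
    inner₁ 0# ℕ.+ m ℕ.* ∑ Φs inner₁
      ≡⟨ cong₂ (λ a b → a ℕ.+ m ℕ.* b) (inner₁-expand 0#) ∑Φ-inner₁ ⟩
    (g 0# 0# 0# ℕ.+ m ℕ.* ∑Φ (g 0# 0#) ℕ.+ m ℕ.* (∑Φ (λ v → g 0# v 0#) ℕ.+ m ℕ.* ∑Φ (λ v → ∑Φ (g 0# v))))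
    ℕ.+ m ℕ.* (∑Φ (λ u → g u 0# 0#) ℕ.+ m ℕ.* ∑Φ (λ u → ∑Φ (g u 0#))
               ℕ.+ m ℕ.* (∑Φ (λ u → ∑Φ (λ v → g u v 0#)) ℕ.+ m ℕ.* ∑Φ (λ u → ∑Φ (λ v → ∑Φ (g u v)))))
      ≡⟨ arith m _ _ _ _ _ _ _ _ ⟩
    _ ∎
    where
    ∑Φ = ∑ Φs
    inner₂ : Carrier → Carrier → ℕ
    inner₂ u v = g u v 0# ℕ.+ m ℕ.* ∑Φ (g u v)
    inner₁ : Carrier → ℕ
    inner₁ u = inner₂ u 0# ℕ.+ m ℕ.* ∑Φ (inner₂ u)
    inner₁-expand : ∀ u → inner₁ u ≡
      g u 0# 0# ℕ.+ m ℕ.* ∑Φ (g u 0#) ℕ.+ m ℕ.* (∑Φ (λ v → g u v 0#) ℕ.+ m ℕ.* ∑Φ (λ v → ∑Φ (g u v)))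
    inner₁-expand u = cong (λ t → inner₂ u 0# ℕ.+ m ℕ.* t) (∑-linear Φs (λ v → g u v 0#) (λ v → ∑Φ (g u v)) m)
    ∑Φ-inner₁ : ∑Φ inner₁ ≡ ∑Φ (λ u → g u 0# 0#) ℕ.+ m ℕ.* ∑Φ (λ u → ∑Φ (g u 0#))
                            ℕ.+ m ℕ.* (∑Φ (λ u → ∑Φ (λ v → g u v 0#)) ℕ.+ m ℕ.* ∑Φ (λ u → ∑Φ (λ v → ∑Φ (g u v))))
    ∑Φ-inner₁ = trans (∑-cong Φs inner₁-expand)
      (trans (∑-linear Φs _ _ m) (cong₂ (λ a b → a ℕ.+ m ℕ.* b) (∑-linear Φs _ _ m) (∑-linear Φs _ _ m)))
    arith : ∀ m a b c d e f g h →
      (a ℕ.+ m ℕ.* b ℕ.+ m ℕ.* (c ℕ.+ m ℕ.* d)) ℕ.+ m ℕ.* (e ℕ.+ m ℕ.* f ℕ.+ m ℕ.* (g ℕ.+ m ℕ.* h)) ≡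
      a ℕ.+ m ℕ.* b ℕ.+ m ℕ.* c ℕ.+ m ℕ.* m ℕ.* d ℕ.+ m ℕ.* e ℕ.+ m ℕ.* m ℕ.* f ℕ.+ m ℕ.* m ℕ.* g ℕ.+ m ℕ.* m ℕ.* m ℕ.* h
    arith = solve-∀

module Characteristic (F : FiniteField) (p r : ℕ) (p-prime : Prime p) (size≡p^r : FiniteField.size F ≡ p ℕ.^ r) where

  open FieldArithmetic F
  open Enumeration F using (ι-size≡0)
  open ≡-Reasoning

  ι-^ : ∀ a n → ι (a ℕ.^ n) ≡ ι a ^ n
  ι-^ a zero = refl
  ι-^ a (suc n) = trans (ι-* a (a ℕ.^ n)) (cong (ι a *_) (ι-^ a n))

  ι-p≡0 : ι p ≡ 0#
  ι-p≡0 = root r (trans (sym (ι-^ p r)) (trans (cong ι (sym size≡p^r)) ι-size≡0))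
    where
    root : ∀ n → ι p ^ n ≡ 0# → ι p ≡ 0#
    root zero 1≡0 = ⊥-elim (1≢0 1≡0)
    root (suc n) ιp^n≡0 = x^[1+n]≡0⇒x≡0 n ιp^n≡0

  ι-∣ : ∀ {d n} → d ∣ n → ι d ≡ 0# → ι n ≡ 0#
  ι-∣ {d} (divides c refl) ιd≡0 = trans (ι-* c d) (trans (cong (ι c *_) ιd≡0) (zeroʳ _))

  ι≡0-from-Bézout : ∀ {d a b} x y → d ℕ.+ y ℕ.* b ≡ x ℕ.* a → ι a ≡ 0# → ι b ≡ 0# → ι d ≡ 0#
  ι≡0-from-Bézout {d} {a} {b} x y d+yb≡xa ιa≡0 ιb≡0 = begin
    ι d                   ≡⟨ solve 2 (λ d u → d := d :+ u :* c0) refl _ (ι y) ⟩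
    ι d + ι y * 0#        ≡⟨ cong (λ t → ι d + ι y * t) (sym ιb≡0) ⟩
    ι d + ι y * ι b       ≡⟨ cong (ι d +_) (sym (ι-* y b)) ⟩
    ι d + ι (y ℕ.* b)     ≡⟨ sym (ι-+ d (y ℕ.* b)) ⟩
    ι (d ℕ.+ y ℕ.* b)     ≡⟨ cong ι d+yb≡xa ⟩
    ι (x ℕ.* a)           ≡⟨ ι-∣ (divides x refl) ιa≡0 ⟩
    0#                    ∎

  ι-gcd≡0 : ∀ {a b} → ι a ≡ 0# → ι b ≡ 0# → ι (gcd a b) ≡ 0#
  ι-gcd≡0 {a} {b} ιa≡0 ιb≡0 with Bézout.identity (gcd-GCD a b)
  ... | Bézout.+- x y d+yb≡xa = ι≡0-from-Bézout x y d+yb≡xa ιa≡0 ιb≡0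
  ... | Bézout.-+ x y d+xa≡yb = ι≡0-from-Bézout y x d+xa≡yb ιb≡0 ιa≡0

  ι-prime≡0⇒≡p : ∀ {q} → Prime q → ι q ≡ 0# → q ≡ p
  ι-prime≡0⇒≡p {q} q-prime ιq≡0 with prime⇒irreducible p-prime (gcd[m,n]∣n q p)
  ... | inj₁ gcd≡1 = ⊥-elim (1≢0 (trans (cong ι (sym gcd≡1)) (ι-gcd≡0 {q} {p} ιq≡0 ι-p≡0)))
  ... | inj₂ gcd≡p with prime⇒irreducible q-prime (subst (_∣ q) gcd≡p (gcd[m,n]∣m q p))
  ...   | inj₁ p≡1 = ⊥-elim (¬prime[1] (subst Prime p≡1 p-prime))
  ...   | inj₂ p≡q = sym p≡q

module SolutionCounts (F : FiniteField) {Φ : FiniteField.Carrier F → Set} {k : ℕ} (isΦ : IsSubgroupOfOrder F Φ k) where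

  open FieldArithmetic F
  open Counting
  open Enumeration F
  open Subgroup F isΦ
  open ≡-Reasoning

  δ : Carrier → Carrier → Carrier → ℕ
  δ u v w = 𝟙 (u + v - w ≟ 1#)

  T : ℕ
  T = ∑[ u ∈ Φs ] ∑[ v ∈ Φs ] ∑[ w ∈ Φs ] δ u v w

  -- the number of solutions in Φ³ with third coordinate w
  σ : Carrier → ℕ
  σ w = ∑[ u ∈ Φs ] 𝟙 (Φ? (1# + w - u))

  T≡∑σ : T ≡ ∑ Φs σ
  T≡∑σ = begin
    ∑[ u ∈ Φs ] ∑[ v ∈ Φs ] ∑[ w ∈ Φs ] δ u v w   ≡⟨ ∑-cong Φs (λ u → ∑-swap Φs Φs (δ u)) ⟩
    ∑[ u ∈ Φs ] ∑[ w ∈ Φs ] ∑[ v ∈ Φs ] δ u v w   ≡⟨ ∑-swap Φs Φs _ ⟩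
    ∑[ w ∈ Φs ] ∑[ u ∈ Φs ] ∑[ v ∈ Φs ] δ u v w   ≡⟨ ∑-cong Φs (λ w → ∑-cong Φs (λ u → v-determined u w)) ⟩
    ∑ Φs σ                                        ∎
    where
    v-determined : ∀ u w → ∑[ v ∈ Φs ] δ u v w ≡ 𝟙 (Φ? (1# + w - u))
    v-determined u w = count-Φ-unique (λ v → u + v - w ≟ 1#) (1# + w - u)
      (λ v eq → trans (solve 3 (λ u v w → v := (u :+ v :- w) :+ w :- u) refl u v w) (cong (λ t → t + w - u) eq))
      (solve 2 (λ u w → u :+ (c1 :+ w :- u) :- w := c1) refl u w)

  -- the number of solutions in Φ³ with first coordinate u
  row : Carrier → ℕ
  row u = ∑[ v ∈ Φs ] 𝟙 (Φ? (u + v - 1#))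

  T≡∑row : T ≡ ∑ Φs row
  T≡∑row = ∑-cong Φs (λ u → ∑-cong Φs (λ v → count-Φ-unique (λ w → u + v - w ≟ 1#) (u + v - 1#)
    (λ w eq → trans (solve 3 (λ u v w → w := u :+ v :- (u :+ v :- w)) refl u v w) (cong (λ t → u + v - t) eq))
    (solve 2 (λ u v → u :+ v :- (u :+ v :- c1) := c1) refl u v)))

  row-1 : row 1# ≡ k
  row-1 = trans (∑-cong-∈ Φs (λ v v∈ → 𝟙-yes (Φ? _) (Φ-cong (solve 1 (λ v → v := c1 :+ v :- c1) refl v) (∈Φs⇒Φ v∈))))
    (trans (∑Φ-const 1) (ℕP.*-identityʳ k))

  1≤row : ∀ {u} → Φ u → 1 ≤ row u
  1≤row {u} Φu = 1≤count Φs Φs-unique (λ v → Φ? (u + v - 1#)) 1# (∈Φs Φ-one)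
    (Φ-cong (solve 1 (λ u → u := u :+ c1 :- c1) refl u) Φu)

  -- v = (z - 1)(zᵢ - 1) lies in row z, as z + v - 1 = (z - 1) zᵢ.
  2≤row : ∀ {z z₁ z₂} → z₁ ≢ z₂ → Φ z₁ → Φ z₂ → Φ (z₁ - 1#) → Φ (z₂ - 1#) → Φ (z - 1#) → 2 ≤ row z
  2≤row {z} {z₁} {z₂} z₁≢z₂ Φz₁ Φz₂ Φz₁-1 Φz₂-1 Φz-1 =
    2≤count Φs Φs-unique (λ v → Φ? (z + v - 1#)) ((z - 1#) * (z₁ - 1#)) ((z - 1#) * (z₂ - 1#))
      (∈Φs (Φ-* Φz-1 Φz₁-1)) (∈Φs (Φ-* Φz-1 Φz₂-1)) distinct
      (Φ-cong (sym (in-row z₁)) (Φ-* Φz-1 Φz₁)) (Φ-cong (sym (in-row z₂)) (Φ-* Φz-1 Φz₂))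
    where
    in-row : ∀ w → z + (z - 1#) * (w - 1#) - 1# ≡ (z - 1#) * w
    in-row w = solve 2 (λ z w → z :+ (z :- c1) :* (w :- c1) :- c1 := (z :- c1) :* w) refl z w
    distinct : (z - 1#) * (z₁ - 1#) ≢ (z - 1#) * (z₂ - 1#)
    distinct eq = z₁≢z₂ (trans (solve 1 (λ a → a := (a :- c1) :+ c1) refl z₁)
      (trans (cong (_+ 1#) (*-cancelˡ (Φ⇒≢0 Φz-1) eq)) (solve 1 (λ a → (a :- c1) :+ c1 := a) refl z₂)))

  -- Every row has a solution, row 1 is full, and rows z₁, z₂ have two each.
  T-lower-bound : ∀ {z₁ z₂} → z₁ ≢ z₂ → Φ z₁ → Φ z₂ → Φ (z₁ - 1#) → Φ (z₂ - 1#) → 2 ℕ.* k < T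
  T-lower-bound {z₁} {z₂} z₁≢z₂ Φz₁ Φz₂ Φz₁-1 Φz₂-1 =
    subst₂ _≤_ (trans ∑base (ℕP.+-comm _ 1)) (sym T≡∑row) (∑-mono-≤ Φs base≤row)
    where
    base : Carrier → ℕ
    base u = 1 ℕ.+ (k ∸ 1) ℕ.* 𝟙 (u ≟ 1#) ℕ.+ 𝟙 (u ≟ z₁) ℕ.+ 𝟙 (u ≟ z₂)
    ≢1 : ∀ {z} → Φ (z - 1#) → z ≢ 1#
    ≢1 Φz-1 refl = Φ⇒≢0 Φz-1 (-‿inverseʳ 1#)
    2≤row′ : ∀ {z} → Φ (z - 1#) → 2 ≤ row z
    2≤row′ = 2≤row z₁≢z₂ Φz₁ Φz₂ Φz₁-1 Φz₂-1
    base≤row : ∀ u → u ∈ Φs → base u ≤ row u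
    base≤row u u∈ with u ≟ 1# | u ≟ z₁ | u ≟ z₂
    ... | yes refl | yes 1≡z₁ | _ = ⊥-elim (≢1 Φz₁-1 (sym 1≡z₁))
    ... | yes refl | no _ | yes 1≡z₂ = ⊥-elim (≢1 Φz₂-1 (sym 1≡z₂))
    ... | yes refl | no _ | no _ = ℕP.≤-reflexive (trans (arith k 1≤k) (sym row-1))
      where
      arith : ∀ k → 1 ≤ k → 1 ℕ.+ (k ∸ 1) ℕ.* 1 ℕ.+ 0 ℕ.+ 0 ≡ k
      arith (suc j) _ = cong suc (trans (ℕP.+-identityʳ _) (trans (ℕP.+-identityʳ _) (ℕP.*-identityʳ j)))
    ... | no _ | yes refl | yes refl = ⊥-elim (z₁≢z₂ refl)
    ... | no _ | yes refl | no _ = subst (_≤ row u) (cong (λ t → 1 ℕ.+ t ℕ.+ 1 ℕ.+ 0) (sym (ℕP.*-zeroʳ (k ∸ 1)))) (2≤row′ Φz₁-1)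
    ... | no _ | no _ | yes refl = subst (_≤ row u) (cong (λ t → 1 ℕ.+ t ℕ.+ 0 ℕ.+ 1) (sym (ℕP.*-zeroʳ (k ∸ 1)))) (2≤row′ Φz₂-1)
    ... | no _ | no _ | no _ = subst (_≤ row u) (cong (λ t → 1 ℕ.+ t ℕ.+ 0 ℕ.+ 0) (sym (ℕP.*-zeroʳ (k ∸ 1)))) (1≤row (∈Φs⇒Φ u∈))
    ∑base : ∑ Φs base ≡ 2 ℕ.* k ℕ.+ 1
    ∑base = begin
      ∑ Φs base
        ≡⟨ trans (∑-+ Φs _ _) (cong₂ ℕ._+_ (∑-+ Φs _ _) (count-Φ-point Φz₂)) ⟩
      ∑[ u ∈ Φs ] (1 ℕ.+ (k ∸ 1) ℕ.* 𝟙 (u ≟ 1#)) ℕ.+ ∑[ u ∈ Φs ] 𝟙 (u ≟ z₁) ℕ.+ 1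
        ≡⟨ cong₂ (λ a b → a ℕ.+ b ℕ.+ 1) (∑-linear Φs (λ _ → 1) _ (k ∸ 1)) (count-Φ-point Φz₁) ⟩
      ∑[ _ ∈ Φs ] 1 ℕ.+ (k ∸ 1) ℕ.* ∑[ u ∈ Φs ] 𝟙 (u ≟ 1#) ℕ.+ 1 ℕ.+ 1
        ≡⟨ cong₂ (λ a b → a ℕ.+ (k ∸ 1) ℕ.* b ℕ.+ 1 ℕ.+ 1) (trans (∑Φ-const 1) (ℕP.*-identityʳ k)) (count-Φ-point Φ-one) ⟩
      k ℕ.+ (k ∸ 1) ℕ.* 1 ℕ.+ 1 ℕ.+ 1
        ≡⟨ arith k 1≤k ⟩
      2 ℕ.* k ℕ.+ 1 ∎
      where
      arith : ∀ k → 1 ≤ k → k ℕ.+ (k ∸ 1) ℕ.* 1 ℕ.+ 1 ℕ.+ 1 ≡ 2 ℕ.* k ℕ.+ 1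
      arith (suc j) _ = expand j
        where
        expand : ∀ j → suc j ℕ.+ j ℕ.* 1 ℕ.+ 1 ℕ.+ 1 ≡ 2 ℕ.* suc j ℕ.+ 1
        expand = solve-∀

  -- the solutions with one coordinate 0: (u, v, 0), resp. (0, v, w) and (u, 0, w)
  sumPairs diffPairs : ℕ
  sumPairs = ∑[ u ∈ Φs ] 𝟙 (Φ? (1# - u))
  diffPairs = ∑[ u ∈ Φs ] 𝟙 (Φ? (u - 1#))

  sumPairs≡diffPairs : Φ (- 1#) → sumPairs ≡ diffPairs
  sumPairs≡diffPairs Φ-1 = ∑-cong Φs (λ u → 𝟙-cong (Φ? _) (Φ? _)
    (Φ-cong (solve 1 (λ u → :- c1 :* (c1 :- u) := u :- c1) refl u) ∘ Φ-* Φ-1)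
    (Φ-cong (solve 1 (λ u → :- c1 :* (u :- c1) := c1 :- u) refl u) ∘ Φ-* Φ-1))

  module Decomposition (m : ℕ) (size∸1≡m*k : FiniteField.size F ∸ 1 ≡ m ℕ.* k) where

    open PowerMap F isΦ m size∸1≡m*k

    private
      count3≡∑³ : ∀ (P : Carrier → Carrier → Carrier → Set) P? →
        count3 F P P? ≡ ∑[ x ∈ elements ] ∑[ y ∈ elements ] ∑[ z ∈ elements ] 𝟙 (P? x y z)
      count3≡∑³ P P? = trans (sum-map (allFin size) _) (trans (∑-allFin _) (∑-cong elements (λ x →
        trans (sum-map (allFin size) _) (trans (∑-allFin _) (∑-cong elements (λ y → countF≡∑ (P? x y)))))))

      zero-product : ∀ {a b c} → a * b * c ≡ 0# → a ≡ 0# ⊎ b ≡ 0# ⊎ c ≡ 0#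
      zero-product abc≡0 with x*y≡0⇒x≡0∨y≡0 abc≡0
      ... | inj₂ c≡0 = inj₂ (inj₂ c≡0)
      ... | inj₁ ab≡0 with x*y≡0⇒x≡0∨y≡0 ab≡0
      ...   | inj₁ a≡0 = inj₁ a≡0
      ...   | inj₂ b≡0 = inj₂ (inj₁ b≡0)

      product-zero : ∀ {a b c} → a ≡ 0# ⊎ b ≡ 0# ⊎ c ≡ 0# → a * b * c ≡ 0#
      product-zero {a} {b} {c} (inj₁ refl) = solve 2 (λ b c → c0 :* b :* c := c0) refl b c
      product-zero {a} {b} {c} (inj₂ (inj₁ refl)) = solve 2 (λ a c → a :* c0 :* c := c0) refl a c
      product-zero {a} {b} {c} (inj₂ (inj₂ refl)) = zeroʳ _

      ^m-zero-product : ∀ {x y z} → x * y * z ≡ 0# → x ^ m * y ^ m * z ^ m ≡ 0#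
      ^m-zero-product xyz≡0 with zero-product xyz≡0
      ... | inj₁ refl = product-zero (inj₁ 0^m≡0)
      ... | inj₂ (inj₁ refl) = product-zero (inj₂ (inj₁ 0^m≡0))
      ... | inj₂ (inj₂ refl) = product-zero (inj₂ (inj₂ 0^m≡0))

      zero-product-^m : ∀ {x y z} → x ^ m * y ^ m * z ^ m ≡ 0# → x * y * z ≡ 0#
      zero-product-^m xyz≡0 with zero-product xyz≡0
      ... | inj₁ x^m≡0 = product-zero (inj₁ (x^m≡0⇒x≡0 x^m≡0))
      ... | inj₂ (inj₁ y^m≡0) = product-zero (inj₂ (inj₁ (x^m≡0⇒x≡0 y^m≡0)))
      ... | inj₂ (inj₂ z^m≡0) = product-zero (inj₂ (inj₂ (x^m≡0⇒x≡0 z^m≡0)))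

      δ* : Carrier → Carrier → Carrier → ℕ
      δ* u v w = 𝟙 ((u + v - w ≟ 1#) ×-dec ¬? (u * v * w ≟ 0#))

      δ*-boundary : ∀ {u v w} → u ≡ 0# ⊎ v ≡ 0# ⊎ w ≡ 0# → δ* u v w ≡ 0
      δ*-boundary {u} {v} {w} some≡0 = 𝟙-no ((u + v - w ≟ 1#) ×-dec ¬? (u * v * w ≟ 0#)) (λ (_ , uvw≢0) → uvw≢0 (product-zero some≡0))

      ∑Φ-δ*≡T : ∑[ u ∈ Φs ] ∑[ v ∈ Φs ] ∑[ w ∈ Φs ] δ* u v w ≡ T
      ∑Φ-δ*≡T = ∑-cong-∈ Φs (λ u u∈ → ∑-cong-∈ Φs (λ v v∈ → ∑-cong-∈ Φs (λ w w∈ → 𝟙-cong _ _ proj₁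
        (λ eq → eq , λ uvw≡0 → nonzero-coordinate (∈Φs⇒Φ u∈) (∈Φs⇒Φ v∈) (∈Φs⇒Φ w∈) (zero-product uvw≡0)))))
        where
        nonzero-coordinate : ∀ {a b c} → Φ a → Φ b → Φ c → ¬ (a ≡ 0# ⊎ b ≡ 0# ⊎ c ≡ 0#)
        nonzero-coordinate Φa _ _ (inj₁ a≡0) = Φ⇒≢0 Φa a≡0
        nonzero-coordinate _ Φb _ (inj₂ (inj₁ b≡0)) = Φ⇒≢0 Φb b≡0
        nonzero-coordinate _ _ Φc (inj₂ (inj₂ c≡0)) = Φ⇒≢0 Φc c≡0

      ∑Φ-zero : ∀ {f : Carrier → ℕ} → (∀ x → f x ≡ 0) → ∑ Φs f ≡ 0
      ∑Φ-zero f≡0 = ∑-zero Φs (λ x _ → f≡0 x)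

      δ000 : δ 0# 0# 0# ≡ 0
      δ000 = 𝟙-no (0# + 0# - 0# ≟ 1#) (λ eq → 0≢1 (trans (solve 0 (c0 := c0 :+ c0 :- c0) refl) eq))

      ∑δ00w : ∑[ w ∈ Φs ] δ 0# 0# w ≡ 𝟙 (Φ? (- 1#))
      ∑δ00w = count-Φ-unique (λ w → 0# + 0# - w ≟ 1#) (- 1#)
        (λ w eq → trans (solve 1 (λ w → w := :- (c0 :+ c0 :- w)) refl w) (cong -_ eq))
        (solve 0 (c0 :+ c0 :- (:- c1) := c1) refl)

      ∑δ0v0 : ∑[ v ∈ Φs ] δ 0# v 0# ≡ 1
      ∑δ0v0 = trans (count-Φ-unique (λ v → 0# + v - 0# ≟ 1#) 1#
        (λ v eq → trans (solve 1 (λ v → v := c0 :+ v :- c0) refl v) eq) (solve 0 (c0 :+ c1 :- c0 := c1) refl))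
        (𝟙-yes (Φ? 1#) Φ-one)

      ∑δu00 : ∑[ u ∈ Φs ] δ u 0# 0# ≡ 1
      ∑δu00 = trans (count-Φ-unique (λ u → u + 0# - 0# ≟ 1#) 1#
        (λ u eq → trans (solve 1 (λ u → u := u :+ c0 :- c0) refl u) eq) (solve 0 (c1 :+ c0 :- c0 := c1) refl))
        (𝟙-yes (Φ? 1#) Φ-one)

      ∑∑δ0vw : ∑[ v ∈ Φs ] ∑[ w ∈ Φs ] δ 0# v w ≡ diffPairs
      ∑∑δ0vw = ∑-cong Φs (λ v → count-Φ-unique (λ w → 0# + v - w ≟ 1#) (v - 1#)
        (λ w eq → trans (solve 2 (λ v w → w := v :- (c0 :+ v :- w)) refl v w) (cong (λ t → v - t) eq))
        (solve 1 (λ v → c0 :+ v :- (v :- c1) := c1) refl v))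

      ∑∑δu0w : ∑[ u ∈ Φs ] ∑[ w ∈ Φs ] δ u 0# w ≡ diffPairs
      ∑∑δu0w = ∑-cong Φs (λ u → count-Φ-unique (λ w → u + 0# - w ≟ 1#) (u - 1#)
        (λ w eq → trans (solve 2 (λ u w → w := u :- (u :+ c0 :- w)) refl u w) (cong (λ t → u - t) eq))
        (solve 1 (λ u → u :+ c0 :- (u :- c1) := c1) refl u))

      ∑∑δuv0 : ∑[ u ∈ Φs ] ∑[ v ∈ Φs ] δ u v 0# ≡ sumPairs
      ∑∑δuv0 = ∑-cong Φs (λ u → count-Φ-unique (λ v → u + v - 0# ≟ 1#) (1# - u)
        (λ v eq → trans (solve 2 (λ u v → v := (u :+ v :- c0) :- u) refl u v) (cong (_- u) eq))
        (solve 1 (λ u → u :+ (c1 :- u) :- c0 := c1) refl u))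

    N≡ : N F m ≡ m ℕ.* 𝟙 (Φ? (- 1#)) ℕ.+ 2 ℕ.* m ℕ.+ 2 ℕ.* (m ℕ.* m) ℕ.* diffPairs
                 ℕ.+ m ℕ.* m ℕ.* sumPairs ℕ.+ m ℕ.* m ℕ.* m ℕ.* T
    N≡ = begin
      N F m
        ≡⟨ count3≡∑³ _ _ ⟩
      ∑[ x ∈ elements ] ∑[ y ∈ elements ] ∑[ z ∈ elements ] δ (x ^ m) (y ^ m) (z ^ m)
        ≡⟨ ∑³-^m δ ⟩
      δ 0# 0# 0# ℕ.+ m ℕ.* ∑[ w ∈ Φs ] δ 0# 0# w ℕ.+ m ℕ.* ∑[ v ∈ Φs ] δ 0# v 0#
      ℕ.+ m ℕ.* m ℕ.* ∑[ v ∈ Φs ] ∑[ w ∈ Φs ] δ 0# v w ℕ.+ m ℕ.* ∑[ u ∈ Φs ] δ u 0# 0#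
      ℕ.+ m ℕ.* m ℕ.* ∑[ u ∈ Φs ] ∑[ w ∈ Φs ] δ u 0# w ℕ.+ m ℕ.* m ℕ.* ∑[ u ∈ Φs ] ∑[ v ∈ Φs ] δ u v 0#
      ℕ.+ m ℕ.* m ℕ.* m ℕ.* T
        ≡⟨ cong₂ (λ a b → a ℕ.+ m ℕ.* m ℕ.* b ℕ.+ m ℕ.* m ℕ.* m ℕ.* T)
            (cong₂ (λ a b → a ℕ.+ m ℕ.* m ℕ.* b)
              (cong₂ (λ a b → a ℕ.+ m ℕ.* b)
                (cong₂ (λ a b → a ℕ.+ m ℕ.* m ℕ.* b)
                  (cong₂ (λ a b → a ℕ.+ m ℕ.* b) (cong₂ (λ a b → a ℕ.+ m ℕ.* b) δ000 ∑δ00w) ∑δ0v0) ∑∑δ0vw) ∑δu00) ∑∑δu0w) ∑∑δuv0 ⟩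
      0 ℕ.+ m ℕ.* 𝟙 (Φ? (- 1#)) ℕ.+ m ℕ.* 1 ℕ.+ m ℕ.* m ℕ.* diffPairs ℕ.+ m ℕ.* 1
      ℕ.+ m ℕ.* m ℕ.* diffPairs ℕ.+ m ℕ.* m ℕ.* sumPairs ℕ.+ m ℕ.* m ℕ.* m ℕ.* T
        ≡⟨ arith m (𝟙 (Φ? (- 1#))) diffPairs sumPairs T ⟩
      m ℕ.* 𝟙 (Φ? (- 1#)) ℕ.+ 2 ℕ.* m ℕ.+ 2 ℕ.* (m ℕ.* m) ℕ.* diffPairs ℕ.+ m ℕ.* m ℕ.* sumPairs ℕ.+ m ℕ.* m ℕ.* m ℕ.* T ∎
      where
      arith : ∀ m f z s t → 0 ℕ.+ m ℕ.* f ℕ.+ m ℕ.* 1 ℕ.+ m ℕ.* m ℕ.* z ℕ.+ m ℕ.* 1 ℕ.+ m ℕ.* m ℕ.* z ℕ.+ m ℕ.* m ℕ.* s ℕ.+ m ℕ.* m ℕ.* m ℕ.* t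
        ≡ m ℕ.* f ℕ.+ 2 ℕ.* m ℕ.+ 2 ℕ.* (m ℕ.* m) ℕ.* z ℕ.+ m ℕ.* m ℕ.* s ℕ.+ m ℕ.* m ℕ.* m ℕ.* t
      arith = solve-∀

    N'≡ : N' F m ≡ m ℕ.* m ℕ.* m ℕ.* T
    N'≡ = begin
      N' F m
        ≡⟨ count3≡∑³ _ _ ⟩
      ∑[ x ∈ elements ] ∑[ y ∈ elements ] ∑[ z ∈ elements ] 𝟙 ((x ^ m + y ^ m - z ^ m ≟ 1#) ×-dec ¬? (x * y * z ≟ 0#))
        ≡⟨ ∑-cong elements (λ x → ∑-cong elements (λ y → ∑-cong elements (λ z → 𝟙-cong _ _
             (λ (eq , xyz≢0) → eq , λ x^my^mz^m≡0 → xyz≢0 (zero-product-^m x^my^mz^m≡0))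
             (λ (eq , x^my^mz^m≢0) → eq , λ xyz≡0 → x^my^mz^m≢0 (^m-zero-product xyz≡0))))) ⟩
      ∑[ x ∈ elements ] ∑[ y ∈ elements ] ∑[ z ∈ elements ] δ* (x ^ m) (y ^ m) (z ^ m)
        ≡⟨ ∑³-^m δ* ⟩
      _ ≡⟨ cong₂ (λ a b → a ℕ.+ m ℕ.* m ℕ.* m ℕ.* b) boundary ∑Φ-δ*≡T ⟩
      0 ℕ.+ m ℕ.* m ℕ.* m ℕ.* T
        ∎
      where
      z₁ : ∀ {v w} → δ* 0# v w ≡ 0
      z₁ = δ*-boundary (inj₁ refl)
      z₂ : ∀ {u w} → δ* u 0# w ≡ 0
      z₂ = δ*-boundary (inj₂ (inj₁ refl))
      z₃ : ∀ {u v} → δ* u v 0# ≡ 0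
      z₃ = δ*-boundary (inj₂ (inj₂ refl))
      boundary : δ* 0# 0# 0# ℕ.+ m ℕ.* ∑[ w ∈ Φs ] δ* 0# 0# w ℕ.+ m ℕ.* ∑[ v ∈ Φs ] δ* 0# v 0#
        ℕ.+ m ℕ.* m ℕ.* ∑[ v ∈ Φs ] ∑[ w ∈ Φs ] δ* 0# v w ℕ.+ m ℕ.* ∑[ u ∈ Φs ] δ* u 0# 0#
        ℕ.+ m ℕ.* m ℕ.* ∑[ u ∈ Φs ] ∑[ w ∈ Φs ] δ* u 0# w ℕ.+ m ℕ.* m ℕ.* ∑[ u ∈ Φs ] ∑[ v ∈ Φs ] δ* u v 0# ≡ 0
      boundary = trans
        (cong₂ (λ a b → a ℕ.+ m ℕ.* m ℕ.* b)
          (cong₂ (λ a b → a ℕ.+ m ℕ.* m ℕ.* b)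
            (cong₂ (λ a b → a ℕ.+ m ℕ.* b)
              (cong₂ (λ a b → a ℕ.+ m ℕ.* m ℕ.* b)
                (cong₂ (λ a b → a ℕ.+ m ℕ.* b) (cong₂ (λ a b → a ℕ.+ m ℕ.* b) z₁ (∑Φ-zero λ _ → z₁)) (∑Φ-zero λ _ → z₁))
                (∑Φ-zero λ _ → ∑Φ-zero λ _ → z₁))
              (∑Φ-zero λ _ → z₂))
            (∑Φ-zero λ _ → ∑Φ-zero λ _ → z₂))
          (∑Φ-zero λ _ → ∑Φ-zero λ _ → z₃))
        (arith m)
        where
        arith : ∀ m → 0 ℕ.+ m ℕ.* 0 ℕ.+ m ℕ.* 0 ℕ.+ m ℕ.* m ℕ.* 0 ℕ.+ m ℕ.* 0 ℕ.+ m ℕ.* m ℕ.* 0 ℕ.+ m ℕ.* m ℕ.* 0 ≡ 0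
        arith = solve-∀

module CircularSubgroup (F : FiniteField) {Φ : FiniteField.Carrier F → Set} {k : ℕ} (isΦ : IsSubgroupOfOrder F Φ k)
  (circular : Circular F Φ) (2≤k : 2 ≤ k) where

  open FieldArithmetic F
  open Counting
  open Enumeration F
  open Subgroup F isΦ
  open SolutionCounts F isΦ
  open ≡-Reasoning

  -- Circularity with a = 1, b = -1: the set Φ ∩ (c - Φ) has at most two elements.
  at-most-two : ∀ c {x y z} → c ≢ 0# → Φ x → Φ (c - x) → Φ y → Φ (c - y) → Φ z → Φ (c - z) →
    x ≡ y ⊎ x ≡ z ⊎ y ≡ z
  at-most-two c {x} {y} {z} c≢0 Φx Φc-x Φy Φc-y Φz Φc-z =
    circular 1# (- 1#) c 1≢0 -1≢0 c≢0 x y z (member Φx Φc-x) (member Φy Φc-y) (member Φz Φc-z)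
    where
    member : ∀ {u} → Φ u → Φ (c - u) → InCoset F Φ 1# u × InShift F Φ (- 1#) c u
    member {u} Φu Φc-u = (u , Φu , sym (*-identityʳ u)) ,
      (c - u , Φc-u , solve 2 (λ c u → u := (c :- u) :* (:- c1) :+ c) refl c u)

  1+w≡0⇒w≡-1 : ∀ {w} → 1# + w ≡ 0# → w ≡ - 1#
  1+w≡0⇒w≡-1 {w} 1+w≡0 = trans (solve 1 (λ w → w := (c1 :+ w) :- c1) refl w) (trans (cong (_- 1#) 1+w≡0) (+-identityˡ _))

  -- When 1 + w = 0 the condition 1 + w - u ∈ Φ reads w u ∈ Φ, true for every u ∈ Φ.
  σ-at-[1+w≡0] : ∀ {w} → 1# + w ≡ 0# → Φ w → σ w ≡ k
  σ-at-[1+w≡0] {w} 1+w≡0 Φw = trans (∑-cong-∈ Φs (λ u u∈ → 𝟙-yes (Φ? _) (Φ-cong (wu≡1+w-u u) (Φ-* Φw (∈Φs⇒Φ u∈)))))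
    (trans (∑Φ-const 1) (ℕP.*-identityʳ k))
    where
    wu≡1+w-u : ∀ u → w * u ≡ 1# + w - u
    wu≡1+w-u u = begin
      w * u                       ≡⟨ solve 2 (λ w u → w :* u := w :* u :+ c0 :* (c1 :- u)) refl w u ⟩
      w * u + 0# * (1# - u)       ≡⟨ cong (λ t → w * u + t * (1# - u)) (sym 1+w≡0) ⟩
      w * u + (1# + w) * (1# - u) ≡⟨ solve 2 (λ w u → w :* u :+ (c1 :+ w) :* (c1 :- u) := c1 :+ w :- u) refl w u ⟩
      1# + w - u                  ∎

  σ-at-1 : ι 2 ≢ 0# → σ 1# ≡ 1
  σ-at-1 ι2≢0 = count≡1 Φs Φs-unique (λ u → Φ? (1# + 1# - u)) 1# (∈Φs Φ-one) only (Φ-cong 1≡2-1 Φ-one)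
    where
    1≡2-1 : 1# ≡ 1# + 1# - 1#
    1≡2-1 = solve 0 (c1 := c1 :+ c1 :- c1) refl
    only : ∀ u → u ∈ Φs → Φ (1# + 1# - u) → u ≡ 1#
    only u u∈ Φ2-u with at-most-two (1# + 1#) ι2≢0 Φ-one (Φ-cong 1≡2-1 Φ-one) (∈Φs⇒Φ u∈) Φ2-u
                          Φ2-u (Φ-cong (solve 1 (λ u → u := c1 :+ c1 :- (c1 :+ c1 :- u)) refl u) (∈Φs⇒Φ u∈))
    ... | inj₁ 1≡u = sym 1≡u
    ... | inj₂ (inj₁ 1≡2-u) = trans (solve 1 (λ u → u := c1 :+ c1 :- (c1 :+ c1 :- u)) refl u)
                                (trans (cong (λ t → 1# + 1# - t) (sym 1≡2-u)) (sym 1≡2-1))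
    ... | inj₂ (inj₂ u≡2-u) = *-cancelˡ ι2≢0 (begin
        (1# + 1#) * u    ≡⟨ solve 1 (λ u → (c1 :+ c1) :* u := u :+ u) refl u ⟩
        u + u            ≡⟨ cong (u +_) u≡2-u ⟩
        u + (1# + 1# - u) ≡⟨ solve 1 (λ u → u :+ (c1 :+ c1 :- u) := (c1 :+ c1) :* c1) refl u ⟩
        (1# + 1#) * 1#   ∎)

  -- Otherwise the two solutions are u = 1 and u = w.
  σ-generic : ∀ {w} → 1# + w ≢ 0# → w ≢ 1# → Φ w → σ w ≡ 2
  σ-generic {w} 1+w≢0 w≢1 Φw = count≡2 Φs Φs-unique (λ u → Φ? (1# + w - u)) 1# w (∈Φs Φ-one) (∈Φs Φw) (λ 1≡w → w≢1 (sym 1≡w))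
    only (Φ-cong w≡1+w-1 Φw) (Φ-cong 1≡1+w-w Φ-one)
    where
    w≡1+w-1 : w ≡ 1# + w - 1#
    w≡1+w-1 = solve 1 (λ w → w := c1 :+ w :- c1) refl w
    1≡1+w-w : 1# ≡ 1# + w - w
    1≡1+w-w = solve 1 (λ w → c1 := c1 :+ w :- w) refl w
    only : ∀ u → u ∈ Φs → Φ (1# + w - u) → u ≡ 1# ⊎ u ≡ w
    only u u∈ Φ1+w-u with at-most-two (1# + w) 1+w≢0 (∈Φs⇒Φ u∈) Φ1+w-u Φ-one (Φ-cong w≡1+w-1 Φw) Φw (Φ-cong 1≡1+w-w Φ-one)
    ... | inj₁ u≡1 = inj₁ u≡1
    ... | inj₂ (inj₁ u≡w) = inj₂ u≡w
    ... | inj₂ (inj₂ 1≡w) = ⊥-elim (w≢1 (sym 1≡w))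

  private
    ∑Φ-two : ∑[ _ ∈ Φs ] 2 ≡ 2 ℕ.* k
    ∑Φ-two = trans (∑Φ-const 2) (ℕP.*-comm k 2)

  T-odd : ¬ Φ (- 1#) → ι 2 ≢ 0# → T ≡ 2 ℕ.* k ∸ 1
  T-odd ¬Φ-1 ι2≢0 = begin
    T                                          ≡⟨ sym (ℕP.m+n∸n≡m T 1) ⟩
    T ℕ.+ 1 ∸ 1                                ≡⟨ cong (_∸ 1) (begin
      T ℕ.+ 1                                  ≡⟨ cong₂ ℕ._+_ T≡∑σ (sym (count-Φ-point Φ-one)) ⟩
      ∑ Φs σ ℕ.+ ∑[ w ∈ Φs ] 𝟙 (w ≟ 1#)        ≡⟨ sym (∑-+ Φs _ _) ⟩
      ∑[ w ∈ Φs ] (σ w ℕ.+ 𝟙 (w ≟ 1#))         ≡⟨ ∑-cong-∈ Φs two-each ⟩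
      ∑[ _ ∈ Φs ] 2                            ≡⟨ ∑Φ-two ⟩
      2 ℕ.* k                                  ∎) ⟩
    2 ℕ.* k ∸ 1                                ∎
    where
    two-each : ∀ w → w ∈ Φs → σ w ℕ.+ 𝟙 (w ≟ 1#) ≡ 2
    two-each w w∈ with w ≟ 1#
    ... | yes refl = cong (ℕ._+ 1) (σ-at-1 ι2≢0)
    ... | no w≢1 = trans (ℕP.+-identityʳ _)
          (σ-generic (λ 1+w≡0 → ¬Φ-1 (Φ-cong (1+w≡0⇒w≡-1 1+w≡0) (∈Φs⇒Φ w∈))) w≢1 (∈Φs⇒Φ w∈))

  T-even : Φ (- 1#) → ι 2 ≢ 0# → T ≡ 3 ℕ.* (k ∸ 1)
  T-even Φ-1 ι2≢0 = ℕP.+-cancelʳ-≡ 1 T _ (begin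
    T ℕ.+ 1                                                   ≡⟨ cong₂ ℕ._+_ T≡∑σ (sym (count-Φ-point Φ-one)) ⟩
    ∑ Φs σ ℕ.+ ∑[ w ∈ Φs ] 𝟙 (w ≟ 1#)                         ≡⟨ sym (∑-+ Φs _ _) ⟩
    ∑[ w ∈ Φs ] (σ w ℕ.+ 𝟙 (w ≟ 1#))                          ≡⟨ ∑-cong-∈ Φs per-w ⟩
    ∑[ w ∈ Φs ] (2 ℕ.+ (k ∸ 2) ℕ.* 𝟙 (w ≟ - 1#))              ≡⟨ ∑-linear Φs (λ _ → 2) _ (k ∸ 2) ⟩
    ∑[ _ ∈ Φs ] 2 ℕ.+ (k ∸ 2) ℕ.* ∑[ w ∈ Φs ] 𝟙 (w ≟ - 1#)    ≡⟨ cong₂ (λ a b → a ℕ.+ (k ∸ 2) ℕ.* b) ∑Φ-two (count-Φ-point Φ-1) ⟩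
    2 ℕ.* k ℕ.+ (k ∸ 2) ℕ.* 1                                 ≡⟨ arith k 2≤k ⟩
    3 ℕ.* (k ∸ 1) ℕ.+ 1                                       ∎)
    where
    arith : ∀ k → 2 ≤ k → 2 ℕ.* k ℕ.+ (k ∸ 2) ℕ.* 1 ≡ 3 ℕ.* (k ∸ 1) ℕ.+ 1
    arith (suc (suc j)) (s≤s (s≤s _)) = expand j
      where
      expand : ∀ j → 2 ℕ.* suc (suc j) ℕ.+ j ℕ.* 1 ≡ 3 ℕ.* suc j ℕ.+ 1
      expand = solve-∀
    -1≢1 : - 1# ≢ 1#
    -1≢1 -1≡1 = ι2≢0 (trans (cong (1# +_) (sym -1≡1)) (-‿inverseʳ 1#))
    k≡2+[k∸2] : k ≡ 2 ℕ.+ (k ∸ 2)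
    k≡2+[k∸2] = sym (ℕP.m+[n∸m]≡n 2≤k)
    per-w : ∀ w → w ∈ Φs → σ w ℕ.+ 𝟙 (w ≟ 1#) ≡ 2 ℕ.+ (k ∸ 2) ℕ.* 𝟙 (w ≟ - 1#)
    per-w w w∈ with w ≟ - 1# | w ≟ 1#
    ... | yes refl | yes -1≡1 = ⊥-elim (-1≢1 -1≡1)
    ... | yes refl | no _ = trans (ℕP.+-identityʳ _)
          (trans (σ-at-[1+w≡0] (-‿inverseʳ 1#) Φ-1) (trans k≡2+[k∸2] (cong (2 ℕ.+_) (sym (ℕP.*-identityʳ _)))))
    ... | no _ | yes refl = trans (cong (ℕ._+ 1) (σ-at-1 ι2≢0)) (cong (2 ℕ.+_) (sym (ℕP.*-zeroʳ (k ∸ 2))))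
    ... | no w≢-1 | no w≢1 = trans (ℕP.+-identityʳ _)
          (trans (σ-generic (λ 1+w≡0 → w≢-1 (1+w≡0⇒w≡-1 1+w≡0)) w≢1 (∈Φs⇒Φ w∈)) (cong (2 ℕ.+_) (sym (ℕP.*-zeroʳ (k ∸ 2)))))

  T-char2 : ι 2 ≡ 0# → T ≡ 3 ℕ.* k ∸ 2
  T-char2 ι2≡0 = begin
    T                                                     ≡⟨ T≡∑σ ⟩
    ∑ Φs σ                                                ≡⟨ ∑-cong-∈ Φs per-w ⟩
    ∑[ w ∈ Φs ] (2 ℕ.+ (k ∸ 2) ℕ.* 𝟙 (w ≟ 1#))             ≡⟨ ∑-linear Φs (λ _ → 2) _ (k ∸ 2) ⟩
    ∑[ _ ∈ Φs ] 2 ℕ.+ (k ∸ 2) ℕ.* ∑[ w ∈ Φs ] 𝟙 (w ≟ 1#)   ≡⟨ cong₂ (λ a b → a ℕ.+ (k ∸ 2) ℕ.* b) ∑Φ-two (count-Φ-point Φ-one) ⟩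
    2 ℕ.* k ℕ.+ (k ∸ 2) ℕ.* 1                             ≡⟨ arith k 2≤k ⟩
    3 ℕ.* k ∸ 2                                           ∎
    where
    arith : ∀ k → 2 ≤ k → 2 ℕ.* k ℕ.+ (k ∸ 2) ℕ.* 1 ≡ 3 ℕ.* k ∸ 2
    arith (suc (suc j)) (s≤s (s≤s _)) = sym (trans (cong (_∸ 2) (expand j)) (ℕP.m+n∸n≡m _ 2))
      where
      expand : ∀ j → 3 ℕ.* suc (suc j) ≡ (2 ℕ.* suc (suc j) ℕ.+ j ℕ.* 1) ℕ.+ 2
      expand = solve-∀
    -1≡1 : - 1# ≡ 1#
    -1≡1 = ι2≡0⇒-1≡1 ι2≡0
    k≡2+[k∸2] : k ≡ 2 ℕ.+ (k ∸ 2)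
    k≡2+[k∸2] = sym (ℕP.m+[n∸m]≡n 2≤k)
    per-w : ∀ w → w ∈ Φs → σ w ≡ 2 ℕ.+ (k ∸ 2) ℕ.* 𝟙 (w ≟ 1#)
    per-w w w∈ with w ≟ 1#
    ... | yes refl = trans (σ-at-[1+w≡0] (trans (cong (1# +_) (sym -1≡1)) (-‿inverseʳ 1#)) Φ-one)
          (trans k≡2+[k∸2] (cong (2 ℕ.+_) (sym (ℕP.*-identityʳ _))))
    ... | no w≢1 = trans (σ-generic (λ 1+w≡0 → w≢1 (trans (1+w≡0⇒w≡-1 1+w≡0) -1≡1)) w≢1 (∈Φs⇒Φ w∈))
          (cong (2 ℕ.+_) (sym (ℕP.*-zeroʳ (k ∸ 2))))

  -- Circularity with c = 1 applied to u, 1 - u and u⁻¹ (note 1 - u⁻¹ = -(1 - u) u⁻¹ ∈ Φ).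
  sumPair-cases : Φ (- 1#) → ∀ {u} → Φ u → Φ (1# - u) → ι 2 * u ≡ 1# ⊎ u ≡ - 1# ⊎ Cyclo6 u
  sumPair-cases Φ-1 {u} Φu Φ1-u with at-most-two 1# 1≢0 Φu Φ1-u Φ1-u (Φ-cong (solve 1 (λ u → u := c1 :- (c1 :- u)) refl u) Φu)
                                   (Φ-⁻¹ Φu) (Φ-cong 1-u⁻¹ (Φ-* (Φ-* Φ-1 Φ1-u) (Φ-⁻¹ Φu)))
    where
    u⁻¹ = u ⁻¹⟨ Φ⇒≢0 Φu ⟩
    1-u⁻¹ : - 1# * (1# - u) * u⁻¹ ≡ 1# - u⁻¹
    1-u⁻¹ = trans (solve 2 (λ u i → :- c1 :* (c1 :- u) :* i := u :* i :- i) refl u u⁻¹) (cong (_- u⁻¹) (*-inverseʳ u (Φ⇒≢0 Φu)))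
  ... | inj₁ u≡1-u = inj₁ (trans (solve 1 (λ u → c2 :* u := u :+ u) refl u)
                         (trans (cong (u +_) u≡1-u) (solve 1 (λ u → u :+ (c1 :- u) := c1) refl u)))
  ... | inj₂ (inj₁ u≡u⁻¹) with x*x≡1⇒x≡±1 u (trans (cong (u *_) u≡u⁻¹) (*-inverseʳ u (Φ⇒≢0 Φu)))
  ...   | inj₁ u≡1 = ⊥-elim (Φ⇒≢0 Φ1-u (trans (cong (λ t → 1# - t) u≡1) (-‿inverseʳ 1#)))
  ...   | inj₂ u≡-1 = inj₂ (inj₁ u≡-1)
  sumPair-cases Φ-1 {u} Φu Φ1-u | inj₂ (inj₂ 1-u≡u⁻¹) = inj₂ (inj₂ (begin
      u * u - u + 1#        ≡⟨ solve 1 (λ u → u :* u :- u :+ c1 := c1 :- u :* (c1 :- u)) refl u ⟩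
      1# - u * (1# - u)     ≡⟨ cong (λ t → 1# - u * t) 1-u≡u⁻¹ ⟩
      1# - u * u ⁻¹⟨ Φ⇒≢0 Φu ⟩ ≡⟨ cong (λ t → 1# - t) (*-inverseʳ u (Φ⇒≢0 Φu)) ⟩
      1# - 1#               ≡⟨ -‿inverseʳ 1# ⟩
      0#                    ∎))

  -- Circularity with c = 1 applied to -1, 2 and 1/2 (all in Φ, with 1 - each also in Φ).
  ι3≡0-if-[-1,2∈Φ] : Φ (- 1#) → Φ (ι 2) → ι 3 ≡ 0#
  ι3≡0-if-[-1,2∈Φ] Φ-1 Φ2 with at-most-two 1# 1≢0 Φ-1 (Φ-cong (solve 0 (c2 := c1 :- :- c1) refl) Φ2) Φ2
                                   (Φ-cong (solve 0 (:- c1 := c1 :- c2) refl) Φ-1) (Φ-⁻¹ Φ2) (Φ-cong (sym 1-½≡½) (Φ-⁻¹ Φ2))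
    where
    ½ = ι 2 ⁻¹⟨ Φ⇒≢0 Φ2 ⟩
    1-½≡½ : 1# - ½ ≡ ½
    1-½≡½ = trans (cong (_- ½) (sym (*-inverseʳ (ι 2) (Φ⇒≢0 Φ2)))) (solve 1 (λ h → c2 :* h :- h := h) refl ½)
  ... | inj₁ -1≡2 = trans (solve 0 (c3 := c1 :+ c2) refl) (trans (cong (1# +_) (sym -1≡2)) (-‿inverseʳ 1#))
  ... | inj₂ (inj₁ -1≡½) = begin
      ι 3                        ≡⟨ solve 0 (c3 := c1 :- c2 :* (:- c1)) refl ⟩
      1# - ι 2 * - 1#            ≡⟨ cong (λ t → 1# - ι 2 * t) -1≡½ ⟩
      1# - ι 2 * ι 2 ⁻¹⟨ _ ⟩      ≡⟨ cong (λ t → 1# - t) (*-inverseʳ (ι 2) (Φ⇒≢0 Φ2)) ⟩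
      1# - 1#                    ≡⟨ -‿inverseʳ 1# ⟩
      0#                         ∎
  ... | inj₂ (inj₂ 2≡½) = begin
      ι 3                        ≡⟨ solve 0 (c3 := c2 :* c2 :- c1) refl ⟩
      ι 2 * ι 2 - 1#             ≡⟨ cong (λ t → ι 2 * t - 1#) 2≡½ ⟩
      ι 2 * ι 2 ⁻¹⟨ _ ⟩ - 1#      ≡⟨ cong (_- 1#) (*-inverseʳ (ι 2) (Φ⇒≢0 Φ2)) ⟩
      1# - 1#                    ≡⟨ -‿inverseʳ 1# ⟩
      0#                         ∎

  sumPairs-Cyclo6 : Φ (- 1#) → ι 3 ≢ 0# → ∀ {ω} → Φ ω → Cyclo6 ω → sumPairs ≡ 2
  sumPairs-Cyclo6 Φ-1 ι3≢0 {ω} Φω cyclo = count≡2 Φs Φs-unique (λ u → Φ? (1# - u)) ω (1# - ω) (∈Φs Φω) (∈Φs Φ1-ω)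
    ω≢1-ω only Φ1-ω (Φ-cong ω≡1-[1-ω] Φω)
    where
    ω≡1-[1-ω] : ω ≡ 1# - (1# - ω)
    ω≡1-[1-ω] = solve 1 (λ w → w := c1 :- (c1 :- w)) refl ω
    Φ1-ω : Φ (1# - ω)
    Φ1-ω = Φ-cong (begin
      - 1# * (ω * ω)               ≡⟨ solve 1 (λ w → :- c1 :* (w :* w) := (c1 :- w) :- (w :* w :- w :+ c1)) refl ω ⟩
      (1# - ω) - (ω * ω - ω + 1#)  ≡⟨ cong (λ t → (1# - ω) - t) cyclo ⟩
      (1# - ω) - 0#                ≡⟨ solve 1 (λ w → (c1 :- w) :- c0 := c1 :- w) refl ω ⟩
      1# - ω                       ∎) (Φ-* Φ-1 (Φ-* Φω Φω))
    ω≢1-ω : ω ≢ 1# - ω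
    ω≢1-ω ω≡1-ω = ι3≢0 (begin
      ι 3                                                   ≡⟨ solve 1 (λ w → c3 := c2 :* c2 :* (w :* w :- w :+ c1) :- (c2 :* w :- c1) :* (c2 :* w :- c1)) refl ω ⟩
      ι 2 * ι 2 * (ω * ω - ω + 1#) - (ι 2 * ω - 1#) * (ι 2 * ω - 1#) ≡⟨ cong₂ (λ a b → ι 2 * ι 2 * a - b * b) cyclo 2ω-1≡0 ⟩
      ι 2 * ι 2 * 0# - 0# * 0#                              ≡⟨ solve 0 (c2 :* c2 :* c0 :- c0 :* c0 := c0) refl ⟩
      0#                                                    ∎)
      where
      2ω-1≡0 : ι 2 * ω - 1# ≡ 0#
      2ω-1≡0 = trans (solve 1 (λ w → c2 :* w :- c1 := w :+ w :- c1) refl ω)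
        (trans (cong (λ t → ω + t - 1#) ω≡1-ω) (solve 1 (λ w → w :+ (c1 :- w) :- c1 := c0) refl ω))
    only : ∀ u → u ∈ Φs → Φ (1# - u) → u ≡ ω ⊎ u ≡ 1# - ω
    only u u∈ Φ1-u with at-most-two 1# 1≢0 (∈Φs⇒Φ u∈) Φ1-u Φω Φ1-ω Φ1-ω (Φ-cong ω≡1-[1-ω] Φω)
    ... | inj₁ u≡ω = inj₁ u≡ω
    ... | inj₂ (inj₁ u≡1-ω) = inj₂ u≡1-ω
    ... | inj₂ (inj₂ ω≡1-ω) = ⊥-elim (ω≢1-ω ω≡1-ω)

  sumPairs-char3 : Φ (- 1#) → ι 3 ≡ 0# → sumPairs ≡ 1
  sumPairs-char3 Φ-1 ι3≡0 = count≡1 Φs Φs-unique (λ u → Φ? (1# - u)) (- 1#) (∈Φs Φ-1) only (Φ-cong -1≡1-[-1] Φ-1)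
    where
    -1≡1-[-1] : - 1# ≡ 1# - - 1#
    -1≡1-[-1] = trans (solve 0 (:- c1 := c1 :- :- c1 :- c3) refl)
      (trans (cong (λ t → 1# - - 1# - t) ι3≡0) (solve 0 (c1 :- :- c1 :- c0 := c1 :- :- c1) refl))
    [u+1]²≡0 : ∀ {u} → Cyclo6 u → (u + 1#) * (u + 1#) ≡ 0#
    [u+1]²≡0 {u} cyclo = begin
      (u + 1#) * (u + 1#)          ≡⟨ solve 1 (λ u → (u :+ c1) :* (u :+ c1) := (u :* u :- u :+ c1) :+ c3 :* u) refl u ⟩
      (u * u - u + 1#) + ι 3 * u   ≡⟨ cong₂ (λ a b → a + b * u) cyclo ι3≡0 ⟩
      0# + 0# * u                  ≡⟨ solve 1 (λ u → c0 :+ c0 :* u := c0) refl u ⟩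
      0#                           ∎
    u+1≡0⇒u≡-1 : ∀ {u} → u + 1# ≡ 0# → u ≡ - 1#
    u+1≡0⇒u≡-1 {u} u+1≡0 = trans (solve 1 (λ u → u := (u :+ c1) :- c1) refl u) (trans (cong (_- 1#) u+1≡0) (+-identityˡ _))
    only : ∀ u → u ∈ Φs → Φ (1# - u) → u ≡ - 1#
    only u u∈ Φ1-u with sumPair-cases Φ-1 (∈Φs⇒Φ u∈) Φ1-u
    ... | inj₁ 2u≡1 = begin
        u                  ≡⟨ solve 1 (λ u → u := c3 :* u :- c2 :* u) refl u ⟩
        ι 3 * u - ι 2 * u  ≡⟨ cong₂ (λ a b → a * u - b) ι3≡0 2u≡1 ⟩
        0# * u - 1#        ≡⟨ solve 1 (λ u → c0 :* u :- c1 := :- c1) refl u ⟩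
        - 1#               ∎
    ... | inj₂ (inj₁ u≡-1) = u≡-1
    ... | inj₂ (inj₂ cyclo) with x*y≡0⇒x≡0∨y≡0 ([u+1]²≡0 cyclo)
    ...   | inj₁ u+1≡0 = u+1≡0⇒u≡-1 u+1≡0
    ...   | inj₂ u+1≡0 = u+1≡0⇒u≡-1 u+1≡0

  Φ2-if-half∈Φ : ∀ {u} → Φ u → ι 2 * u ≡ 1# → Φ (ι 2)
  Φ2-if-half∈Φ Φu 2u≡1 = Φ-inverse Φu (trans (*-comm _ _) 2u≡1)

  sumPairs-no-Cyclo6 : Φ (- 1#) → ι 3 ≢ 0# → ¬ 6 ∣ k → ι 2 ≢ 0# → sumPairs ≡ 0
  sumPairs-no-Cyclo6 Φ-1 ι3≢0 6∤k ι2≢0 = count≡0 Φs (λ u → Φ? (1# - u)) none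
    where
    none : ∀ u → u ∈ Φs → ¬ Φ (1# - u)
    none u u∈ Φ1-u with sumPair-cases Φ-1 (∈Φs⇒Φ u∈) Φ1-u
    ... | inj₁ 2u≡1 = ι3≢0 (ι3≡0-if-[-1,2∈Φ] Φ-1 (Φ2-if-half∈Φ (∈Φs⇒Φ u∈) 2u≡1))
    ... | inj₂ (inj₁ refl) = ι3≢0 (ι3≡0-if-[-1,2∈Φ] Φ-1 (Φ-cong (solve 0 (c1 :- :- c1 := c2) refl) Φ1-u))
    ... | inj₂ (inj₂ cyclo) = 6∤k (Cyclo6⇒6∣k ι2≢0 ι3≢0 (∈Φs⇒Φ u∈) cyclo)

  sumPairs-char2 : ι 2 ≡ 0# → ¬ 3 ∣ k → sumPairs ≡ 0
  sumPairs-char2 ι2≡0 3∤k = count≡0 Φs (λ u → Φ? (1# - u)) none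
    where
    -1≡1 = ι2≡0⇒-1≡1 ι2≡0
    none : ∀ u → u ∈ Φs → ¬ Φ (1# - u)
    none u u∈ Φ1-u with sumPair-cases (Φ-cong (sym -1≡1) Φ-one) (∈Φs⇒Φ u∈) Φ1-u
    ... | inj₁ 2u≡1 = 1≢0 (trans (sym 2u≡1) (trans (cong (_* u) ι2≡0) (zeroˡ u)))
    ... | inj₂ (inj₁ refl) = Φ⇒≢0 Φ1-u (trans (cong (λ t → 1# - t) -1≡1) (-‿inverseʳ 1#))
    ... | inj₂ (inj₂ cyclo) = 3∤k (Cyclo6⇒3∣k ι2≡0 (∈Φs⇒Φ u∈) cyclo)

  module MinusOneOutside (¬Φ-1 : ¬ Φ (- 1#)) (ι2≢0 : ι 2 ≢ 0#) where

    -- Otherwise u⁻¹ and (1 - u)⁻¹ would give T ≥ 2k + 1 > 2k - 1.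
    sumPair⇒half : ∀ {u} → Φ u → Φ (1# - u) → ι 2 * u ≡ 1#
    sumPair⇒half {u} Φu Φ1-u with ι 2 * u ≟ 1#
    ... | yes 2u≡1 = 2u≡1
    ... | no 2u≢1 = ⊥-elim (ℕP.<-irrefl refl (ℕP.<-≤-trans (T-lower-bound z₁≢z₂ (Φ-⁻¹ Φu) (Φ-⁻¹ Φ1-u) Φz₁-1 Φz₂-1)
                      (ℕP.≤-trans (ℕP.≤-reflexive (T-odd ¬Φ-1 ι2≢0)) (ℕP.m∸n≤m (2 ℕ.* k) 1))))
      where
      z₁ = u ⁻¹⟨ Φ⇒≢0 Φu ⟩
      z₂ = (1# - u) ⁻¹⟨ Φ⇒≢0 Φ1-u ⟩
      uz₁≡1 = *-inverseʳ u (Φ⇒≢0 Φu)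
      [1-u]z₂≡1 = *-inverseʳ (1# - u) (Φ⇒≢0 Φ1-u)
      Φz₁-1 : Φ (z₁ - 1#)
      Φz₁-1 = Φ-cong (trans (solve 2 (λ u z → (c1 :- u) :* z := z :- u :* z) refl u z₁) (cong (λ t → z₁ - t) uz₁≡1))
        (Φ-* Φ1-u (Φ-⁻¹ Φu))
      Φz₂-1 : Φ (z₂ - 1#)
      Φz₂-1 = Φ-cong (trans (solve 2 (λ u z → u :* z := z :- (c1 :- u) :* z) refl u z₂) (cong (λ t → z₂ - t) [1-u]z₂≡1))
        (Φ-* Φu (Φ-⁻¹ Φ1-u))
      z₁≢z₂ : z₁ ≢ z₂
      z₁≢z₂ z₁≡z₂ = 2u≢1 (begin
        ι 2 * u         ≡⟨ solve 1 (λ u → c2 :* u := u :+ u) refl u ⟩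
        u + u           ≡⟨ cong (u +_) u≡1-u ⟩
        u + (1# - u)    ≡⟨ solve 1 (λ u → u :+ (c1 :- u) := c1) refl u ⟩
        1#              ∎)
        where
        z₁≢0 : z₁ ≢ 0#
        z₁≢0 z₁≡0 = 1≢0 (trans (sym uz₁≡1) (trans (cong (u *_) z₁≡0) (zeroʳ u)))
        u≡1-u : u ≡ 1# - u
        u≡1-u = *-cancelˡ z₁≢0 (trans (*-comm z₁ u) (trans uz₁≡1 (trans (sym [1-u]z₂≡1)
          (trans (*-comm _ _) (cong (_* (1# - u)) (sym z₁≡z₂))))))

    sumPairs≡[2∈Φ] : sumPairs ≡ 𝟙 (Φ? (ι 2))
    sumPairs≡[2∈Φ] with Φ? (ι 2)
    ... | yes Φ2 = count≡1 Φs Φs-unique (λ u → Φ? (1# - u)) ½ (∈Φs (Φ-⁻¹ Φ2)) only (Φ-cong (sym 1-½≡½) (Φ-⁻¹ Φ2))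
      where
      ½ = ι 2 ⁻¹⟨ Φ⇒≢0 Φ2 ⟩
      1-½≡½ : 1# - ½ ≡ ½
      1-½≡½ = trans (cong (_- ½) (sym (*-inverseʳ (ι 2) (Φ⇒≢0 Φ2)))) (solve 1 (λ h → c2 :* h :- h := h) refl ½)
      only : ∀ u → u ∈ Φs → Φ (1# - u) → u ≡ ½
      only u u∈ Φ1-u = *-cancelˡ ι2≢0 (trans (sumPair⇒half (∈Φs⇒Φ u∈) Φ1-u) (sym (*-inverseʳ (ι 2) (Φ⇒≢0 Φ2))))
    ... | no ¬Φ2 = count≡0 Φs (λ u → Φ? (1# - u))
                     (λ u u∈ Φ1-u → ¬Φ2 (Φ2-if-half∈Φ (∈Φs⇒Φ u∈) (sumPair⇒half (∈Φs⇒Φ u∈) Φ1-u)))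

    diffPair⇒≡2 : ∀ {x} → Φ x → Φ (x - 1#) → x ≡ ι 2
    diffPair⇒≡2 {x} Φx Φx-1 = begin
      x                  ≡⟨ sym (*-identityʳ x) ⟩
      x * 1#             ≡⟨ cong (x *_) (sym 2x⁻¹≡1) ⟩
      x * (ι 2 * x⁻¹)    ≡⟨ solve 3 (λ x t i → x :* (t :* i) := t :* (x :* i)) refl x (ι 2) x⁻¹ ⟩
      ι 2 * (x * x⁻¹)    ≡⟨ cong (ι 2 *_) (*-inverseʳ x (Φ⇒≢0 Φx)) ⟩
      ι 2 * 1#           ≡⟨ *-identityʳ _ ⟩
      ι 2                ∎
      where
      x⁻¹ = x ⁻¹⟨ Φ⇒≢0 Φx ⟩
      2x⁻¹≡1 : ι 2 * x⁻¹ ≡ 1#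
      2x⁻¹≡1 = sumPair⇒half (Φ-⁻¹ Φx) (Φ-cong
        (trans (solve 2 (λ x i → (x :- c1) :* i := x :* i :- i) refl x x⁻¹) (cong (_- x⁻¹) (*-inverseʳ x (Φ⇒≢0 Φx))))
        (Φ-* Φx-1 (Φ-⁻¹ Φx)))

    diffPairs≡[2∈Φ] : diffPairs ≡ 𝟙 (Φ? (ι 2))
    diffPairs≡[2∈Φ] with Φ? (ι 2)
    ... | yes Φ2 = count≡1 Φs Φs-unique (λ u → Φ? (u - 1#)) (ι 2) (∈Φs Φ2) (λ x x∈ Φx-1 → diffPair⇒≡2 (∈Φs⇒Φ x∈) Φx-1)
                     (Φ-cong (solve 0 (c1 := c2 :- c1) refl) Φ-one)
    ... | no ¬Φ2 = count≡0 Φs (λ u → Φ? (u - 1#)) (λ x x∈ Φx-1 → ¬Φ2 (Φ-cong (diffPair⇒≡2 (∈Φs⇒Φ x∈) Φx-1) (∈Φs⇒Φ x∈)))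

open import Data.Nat using (_+_; _*_; _^_)

module MainTheorem (p r k m : ℕ) (p-prime : Prime p) (3≤k : 3 ≤ k)
  (F : FiniteField) (size≡p^r : FiniteField.size F ≡ p ^ r) (p^r∸1≡m*k : p ^ r ∸ 1 ≡ m * k)
  (Φ : FiniteField.Carrier F → Set) (isΦ : IsSubgroupOfOrder F Φ k) (circular : Circular F Φ) where

  private
    2≤k : 2 ≤ k
    2≤k = ℕP.≤-trans (ℕP.n≤1+n 2) 3≤k

    size∸1≡m*k : FiniteField.size F ∸ 1 ≡ m * k
    size∸1≡m*k = trans (cong (_∸ 1) size≡p^r) p^r∸1≡m*k

  open FieldArithmetic F using (0#; 1#; -_; ι; 1≢0; -1≢0; ι2≡0⇒-1≡1; ι2≡0⇒ι3≡1)
  open Counting using (𝟙; 𝟙-yes; 𝟙-no)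
  open Enumeration F using (ι[size∸1]≡-1)
  open Subgroup F isΦ using (Φ?; Φ-one; Φ-cong; -1∈Φ-if-even; -1∈Φ⇒2∣k; Cyclo6-witness-6∣k; Cyclo6-witness-char2)
  open Characteristic F p r p-prime size≡p^r
  open SolutionCounts F isΦ using (T; sumPairs; diffPairs; sumPairs≡diffPairs)
  open SolutionCounts.Decomposition F isΦ m size∸1≡m*k
  open CircularSubgroup F isΦ circular 2≤k

  -- k divides |F| - 1, which is -1 in F.
  p∤k : ¬ p ∣ k
  p∤k p∣k = -1≢0 (trans (sym ι[size∸1]≡-1) (trans (cong ι size∸1≡m*k) (ι-∣ (∣n⇒∣m*n m p∣k) ι-p≡0)))

  ι2≢0 : p ≢ 2 → ι 2 ≢ 0#
  ι2≢0 p≢2 ι2≡0 = p≢2 (sym (ι-prime≡0⇒≡p prime[2] ι2≡0))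

  ι3≡0⇒p≡3 : ι 3 ≡ 0# → p ≡ 3
  ι3≡0⇒p≡3 ι3≡0 = sym (ι-prime≡0⇒≡p (from-yes (prime? 3)) ι3≡0)

  N-value : ∀ {f z s t} → 𝟙 (Φ? (- 1#)) ≡ f → diffPairs ≡ z → sumPairs ≡ s → T ≡ t →
    N F m ≡ m * f + 2 * m + 2 * (m * m) * z + m * m * s + m * m * m * t
  N-value refl refl refl refl = N≡

  -- The arithmetic below spells m ^ 3 as its unfolding m * (m * (m * 1)): solve-∀ does not read Data.Nat._^_.
  N'-value : ∀ {t} → T ≡ t → N' F m ≡ t * m ^ 3
  N'-value {t} refl = trans N'≡ (arith m t)
    where
    arith : ∀ m t → m * m * m * t ≡ t * (m * (m * (m * 1)))
    arith = solve-∀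

  module EvenOrder (2∣k : 2 ∣ k) where

    Φ-1 = -1∈Φ-if-even 2∣k

    p≢2 : p ≢ 2
    p≢2 refl = p∤k 2∣k

    T≡ = T-even Φ-1 (ι2≢0 p≢2)

    N-with : ∀ {s} → sumPairs ≡ s → N F m ≡ m * 1 + 2 * m + 2 * (m * m) * s + m * m * s + m * m * m * (3 * (k ∸ 1))
    N-with sumPairs≡s = N-value (𝟙-yes (Φ? (- 1#)) Φ-1) (trans (sym (sumPairs≡diffPairs Φ-1)) sumPairs≡s) sumPairs≡s T≡

    six-divides : 6 ∣ k → N F m ≡ 3 * (k ∸ 1) * m ^ 3 + 6 * m ^ 2 + 3 * m
    six-divides 6∣k with Cyclo6-witness-6∣k 6∣k
    ... | ω , Φω , cyclo = trans (N-with (sumPairs-Cyclo6 Φ-1 ι3≢0 Φω cyclo)) (arith m _)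
      where
      ι3≢0 : ι 3 ≢ 0#
      ι3≢0 ι3≡0 = p∤k (subst (_∣ k) (sym (ι3≡0⇒p≡3 ι3≡0)) (∣-trans (divides 2 refl) 6∣k))
      arith : ∀ m t → m * 1 + 2 * m + 2 * (m * m) * 2 + m * m * 2 + m * m * m * t ≡ t * (m * (m * (m * 1))) + 6 * (m * (m * 1)) + 3 * m
      arith = solve-∀

    characteristic-3 : p ≡ 3 → N F m ≡ 3 * (k ∸ 1) * m ^ 3 + 3 * m ^ 2 + 3 * m
    characteristic-3 refl = trans (N-with (sumPairs-char3 Φ-1 ι-p≡0)) (arith m _)
      where
      arith : ∀ m t → m * 1 + 2 * m + 2 * (m * m) * 1 + m * m * 1 + m * m * m * t ≡ t * (m * (m * (m * 1))) + 3 * (m * (m * 1)) + 3 * m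
      arith = solve-∀

    otherwise : ¬ 6 ∣ k → p ≢ 3 → N F m ≡ 3 * (k ∸ 1) * m ^ 3 + 3 * m
    otherwise 6∤k p≢3 = trans (N-with (sumPairs-no-Cyclo6 Φ-1 (λ ι3≡0 → p≢3 (ι3≡0⇒p≡3 ι3≡0)) 6∤k (ι2≢0 p≢2))) (arith m _)
      where
      arith : ∀ m t → m * 1 + 2 * m + 2 * (m * m) * 0 + m * m * 0 + m * m * m * t ≡ t * (m * (m * (m * 1))) + 3 * m
      arith = solve-∀

  module Characteristic2 (p≡2 : p ≡ 2) where

    ι2≡0 : ι 2 ≡ 0#
    ι2≡0 = subst (λ q → ι q ≡ 0#) p≡2 ι-p≡0

    Φ-1 : Φ (- 1#)
    Φ-1 = Φ-cong (sym (ι2≡0⇒-1≡1 ι2≡0)) Φ-one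

    T≡ = T-char2 ι2≡0

    N-with : ∀ {s} → sumPairs ≡ s → N F m ≡ m * 1 + 2 * m + 2 * (m * m) * s + m * m * s + m * m * m * (3 * k ∸ 2)
    N-with sumPairs≡s = N-value (𝟙-yes (Φ? (- 1#)) Φ-1) (trans (sym (sumPairs≡diffPairs Φ-1)) sumPairs≡s) sumPairs≡s T≡

    three-divides : 3 ∣ k → N F m ≡ (3 * k ∸ 2) * m ^ 3 + 6 * m ^ 2 + 3 * m
    three-divides 3∣k with Cyclo6-witness-char2 ι2≡0 3∣k
    ... | ω , Φω , cyclo = trans (N-with (sumPairs-Cyclo6 Φ-1 ι3≢0 Φω cyclo)) (arith m _)
      where
      ι3≢0 : ι 3 ≢ 0#
      ι3≢0 ι3≡0 = 1≢0 (trans (sym (ι2≡0⇒ι3≡1 ι2≡0)) ι3≡0)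
      arith : ∀ m t → m * 1 + 2 * m + 2 * (m * m) * 2 + m * m * 2 + m * m * m * t ≡ t * (m * (m * (m * 1))) + 6 * (m * (m * 1)) + 3 * m
      arith = solve-∀

    otherwise : ¬ 3 ∣ k → N F m ≡ (3 * k ∸ 2) * m ^ 3 + 3 * m
    otherwise 3∤k = trans (N-with (sumPairs-char2 ι2≡0 3∤k)) (arith m _)
      where
      arith : ∀ m t → m * 1 + 2 * m + 2 * (m * m) * 0 + m * m * 0 + m * m * m * t ≡ t * (m * (m * (m * 1))) + 3 * m
      arith = solve-∀

  module OddOrderOddCharacteristic (2∤k : ¬ 2 ∣ k) (p≢2 : p ≢ 2) where

    -1∉Φ : ¬ Φ (- 1#)
    -1∉Φ Φ-1 = 2∤k (-1∈Φ⇒2∣k (ι2≢0 p≢2) Φ-1)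

    open MinusOneOutside -1∉Φ (ι2≢0 p≢2)

    T≡ = T-odd -1∉Φ (ι2≢0 p≢2)

    N-with : ∀ {c} → 𝟙 (Φ? (ι 2)) ≡ c → N F m ≡ m * 0 + 2 * m + 2 * (m * m) * c + m * m * c + m * m * m * (2 * k ∸ 1)
    N-with [2∈Φ]≡c = N-value (𝟙-no (Φ? (- 1#)) -1∉Φ) (trans diffPairs≡[2∈Φ] [2∈Φ]≡c) (trans sumPairs≡[2∈Φ] [2∈Φ]≡c) T≡

    two∈Φ : Φ (two F) → N F m ≡ (2 * k ∸ 1) * m ^ 3 + 3 * m ^ 2 + 2 * m
    two∈Φ Φ2 = trans (N-with (𝟙-yes (Φ? (ι 2)) Φ2)) (arith m _)
      where
      arith : ∀ m t → m * 0 + 2 * m + 2 * (m * m) * 1 + m * m * 1 + m * m * m * t ≡ t * (m * (m * (m * 1))) + 3 * (m * (m * 1)) + 2 * m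
      arith = solve-∀

    two∉Φ : ¬ Φ (two F) → N F m ≡ (2 * k ∸ 1) * m ^ 3 + 2 * m
    two∉Φ ¬Φ2 = trans (N-with (𝟙-no (Φ? (ι 2)) ¬Φ2)) (arith m _)
      where
      arith : ∀ m t → m * 0 + 2 * m + 2 * (m * m) * 0 + m * m * 0 + m * m * m * t ≡ t * (m * (m * (m * 1))) + 2 * m
      arith = solve-∀

theorem1 : (p r k m : ℕ) → Prime p → 3 ≤ k →
    (F : FiniteField) → FiniteField.size F ≡ p ^ r →
    p ^ r ∸ 1 ≡ m * k →
    (Φ : FiniteField.Carrier F → Set) → IsSubgroupOfOrder F Φ k →
    Circular F Φ →
    (2 ∣ k →
      (6 ∣ k → N F m ≡ 3 * (k ∸ 1) * m ^ 3 + 6 * m ^ 2 + 3 * m)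
      × (p ≡ 3 → N F m ≡ 3 * (k ∸ 1) * m ^ 3 + 3 * m ^ 2 + 3 * m)
      × (¬ 6 ∣ k → p ≢ 3 → N F m ≡ 3 * (k ∸ 1) * m ^ 3 + 3 * m)
      × N' F m ≡ 3 * (k ∸ 1) * m ^ 3)
    × (¬ 2 ∣ k →
      (p ≡ 2 → 3 ∣ k → N F m ≡ (3 * k ∸ 2) * m ^ 3 + 6 * m ^ 2 + 3 * m)
      × (p ≡ 2 → ¬ 3 ∣ k → N F m ≡ (3 * k ∸ 2) * m ^ 3 + 3 * m)
      × (p ≢ 2 → Φ (two F) → N F m ≡ (2 * k ∸ 1) * m ^ 3 + 3 * m ^ 2 + 2 * m)
      × (p ≢ 2 → ¬ Φ (two F) → N F m ≡ (2 * k ∸ 1) * m ^ 3 + 2 * m)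
      × (p ≡ 2 → N' F m ≡ (3 * k ∸ 2) * m ^ 3)
      × (p ≢ 2 → N' F m ≡ (2 * k ∸ 1) * m ^ 3))
theorem1 p r k m p-prime 3≤k F size≡p^r p^r∸1≡m*k Φ isΦ circular =
  (λ 2∣k → let open EvenOrder 2∣k in six-divides , characteristic-3 , otherwise , N'-value T≡) ,
  (λ 2∤k → let module Odd = OddOrderOddCharacteristic 2∤k in
    Characteristic2.three-divides , Characteristic2.otherwise , Odd.two∈Φ , Odd.two∉Φ ,
    (λ p≡2 → N'-value (Characteristic2.T≡ p≡2)) , (λ p≢2 → N'-value (Odd.T≡ p≢2)))
  where open MainTheorem p r k m p-prime 3≤k F size≡p^r p^r∸1≡m*k Φ isΦ circular
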